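{- Let $G$ be a finite simple graph with vertices totally ordered as $v_1<v_2<\cdots<v_n$, and let $P(G,t)$ be its chromatic polynomial. Then $P(G,t)=IF(G,t)$ if and only if $v_1<v_2<\cdots<v_n$ is a perfect elimination ordering, i.e., for each $i$ the neighbors of $v_i$ that come before $v_i$ in the ordering form a clique of $G$.
   Context: A subtree of $G$ is increasing if the vertices along any path starting at its minimum vertex increase in the ordering. Let $f_k$ be the number of spanning forests of $G$ with $k$ edges all of whose components are increasing trees. The increasing spanning forest generating function is $IF(G,t)=\sum_{k=0}^{n-1}(-1)^k f_k t^{n-k}$. -}

module Defs where

open import Data.Bool using (Bool; true; false; _∧_; _∨_; not; if_then_else_)
open import Data.Nat as ℕ using (ℕ; zero; suc; _∸_; _^_; _≤ᵇ_; _<_)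
open import Data.Fin using (Fin; toℕ)
open import Data.Bool.ListAction using (all; any)
open import Data.List using (List; []; _∷_; _++_; allFin; concatMap; length; map; upTo; foldr)
open import Data.Vec using (Vec; lookup)
import Data.Vec as Vec
open import Data.Product using (_×_; _,_)
open import Data.Integer as ℤ using (ℤ; +_; -_)
open import Relation.Binary.PropositionalEquality using (_≡_; _≢_)

-- A finite simple graph on the vertex set Fin n = {v₁,…,vₙ};
-- the total order of the vertices is the order of Fin n (by toℕ).
record Graph (n : ℕ) : Set where
  field
    adj    : Fin n → Fin n → Bool
    sym    : ∀ u v → adj u v ≡ adj v u
    irrefl : ∀ v → adj v v ≡ false
open Graph public

_==_ : ∀ {n} → Fin n → Fin n → Bool
u == v = toℕ u ℕ.≡ᵇ toℕ v

_<ᵛ_ : ∀ {n} → Fin n → Fin n → Bool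
u <ᵛ v = suc (toℕ u) ≤ᵇ toℕ v

count : ∀ {A : Set} → (A → Bool) → List A → ℕ
count p []       = 0
count p (x ∷ xs) = (if p x then 1 else 0) ℕ.+ count p xs

-- all sublists (subsets, when the list is duplicate-free)
sublists : ∀ {A : Set} → List A → List (List A)
sublists []       = [] ∷ []
sublists (x ∷ xs) = sublists xs ++ map (x ∷_) (sublists xs)

sumℤ : List ℤ → ℤ
sumℤ = foldr ℤ._+_ (+ 0)

allVecs : ∀ (t n : ℕ) → List (Vec (Fin t) n)
allVecs t zero    = Vec.[] ∷ []
allVecs t (suc n) = concatMap (λ c → map (c Vec.∷_) (allVecs t n)) (allFin t)

proper : ∀ {n t} → Graph n → Vec (Fin t) n → Bool
proper {n} G c =
  all (λ u → all (λ v → not (adj G u v) ∨ not (lookup c u == lookup c v)) (allFin n)) (allFin n)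

chromatic : ∀ {n} → Graph n → ℕ → ℕ
chromatic {n} G t = count (proper G) (allVecs t n)

EdgeSet : ℕ → Set
EdgeSet n = List (Fin n × Fin n)

-- E(G): each edge {u,v} listed once as (u , v) with u < v
edges : ∀ {n} → Graph n → EdgeSet n
edges {n} G = concatMap (λ u → concatMap (λ v →
  if (u <ᵛ v) ∧ adj G u v then (u , v) ∷ [] else []) (allFin n)) (allFin n)

adjIn : ∀ {n} → EdgeSet n → Fin n → Fin n → Bool
adjIn S u v = any (λ { (a , b) → (a == u ∧ b == v) ∨ (a == v ∧ b == u) }) S

seqs : ∀ n → ℕ → List (List (Fin n))
seqs n zero    = [] ∷ []
seqs n (suc k) = concatMap (λ v → map (v ∷_) (seqs n k)) (allFin n)

allSeqs : ∀ n → List (List (Fin n))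
allSeqs n = concatMap (seqs n) (upTo (suc n))

distinct : ∀ {n} → List (Fin n) → Bool
distinct []       = true
distinct (x ∷ xs) = not (any (x ==_) xs) ∧ distinct xs

walkIn : ∀ {n} → EdgeSet n → List (Fin n) → Bool
walkIn S []           = true
walkIn S (x ∷ [])     = true
walkIn S (x ∷ y ∷ xs) = adjIn S x y ∧ walkIn S (y ∷ xs)

isPath : ∀ {n} → EdgeSet n → List (Fin n) → Bool
isPath S []       = false
isPath S (x ∷ xs) = distinct (x ∷ xs) ∧ walkIn S (x ∷ xs)

startsAt : ∀ {n} → Fin n → List (Fin n) → Bool
startsAt u []      = false
startsAt u (x ∷ _) = u == x

lastIs : ∀ {n} → Fin n → List (Fin n) → Bool
lastIs u []           = false
lastIs u (x ∷ [])     = u == x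
lastIs u (x ∷ y ∷ xs) = lastIs u (y ∷ xs)

closes : ∀ {n} → EdgeSet n → List (Fin n) → Bool
closes {n} S []       = false
closes {n} S (x ∷ xs) = any (λ y → lastIs y (x ∷ xs) ∧ adjIn S y x) (allFin n)

atLeast3 : ∀ {A : Set} → List A → Bool
atLeast3 (_ ∷ _ ∷ _ ∷ _) = true
atLeast3 _               = false

hasCycle : ∀ {n} → EdgeSet n → Bool
hasCycle {n} S = any (λ p → atLeast3 p ∧ isPath S p ∧ closes S p) (allSeqs n)

isForest : ∀ {n} → EdgeSet n → Bool
isForest S = not (hasCycle S)

connected : ∀ {n} → EdgeSet n → Fin n → Fin n → Bool
connected {n} S u v = any (λ p → isPath S p ∧ startsAt u p ∧ lastIs v p) (allSeqs n)

isComponentMin : ∀ {n} → EdgeSet n → Fin n → Bool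
isComponentMin {n} S m = all (λ u → not (connected S m u) ∨ (toℕ m ≤ᵇ toℕ u)) (allFin n)

increasingSeq : ∀ {n} → List (Fin n) → Bool
increasingSeq []           = true
increasingSeq (x ∷ [])     = true
increasingSeq (x ∷ y ∷ xs) = (x <ᵛ y) ∧ increasingSeq (y ∷ xs)

startsAtComponentMin : ∀ {n} → EdgeSet n → List (Fin n) → Bool
startsAtComponentMin S []      = false
startsAtComponentMin S (x ∷ _) = isComponentMin S x

-- every component is increasing: along any path starting at the minimum
-- vertex of its component, the vertices increase
allComponentsIncreasing : ∀ {n} → EdgeSet n → Bool
allComponentsIncreasing {n} S =
  all (λ p → not (isPath S p ∧ startsAtComponentMin S p) ∨ increasingSeq p) (allSeqs n)

isIncreasingForest : ∀ {n} → EdgeSet n → Bool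
isIncreasingForest S = isForest S ∧ allComponentsIncreasing S

-- f_k : number of spanning forests of G with k edges all of whose
-- components are increasing trees
forestCount : ∀ {n} → Graph n → ℕ → ℕ
forestCount G k =
  count (λ S → isIncreasingForest S ∧ (length S ℕ.≡ᵇ k)) (sublists (edges G))

IF : ∀ {n} → Graph n → ℕ → ℤ
IF {n} G t =
  sumℤ (map (λ k → ((- (+ 1)) ℤ.^ k) ℤ.* (+ (forestCount G k ℕ.* (t ^ (n ∸ k))))) (upTo n))

PerfectEliminationOrdering : ∀ {n} → Graph n → Set
PerfectEliminationOrdering {n} G =
  ∀ (i j k : Fin n) → toℕ j < toℕ i → toℕ k < toℕ i →
  adj G i j ≡ true → adj G i k ≡ true → j ≢ k → adj G j k ≡ true

-- Write d(v) for the number of neighbours of v that precede it. An edge set is an increasing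
-- forest exactly when no vertex has two earlier neighbours in it, i.e. when the larger endpoints
-- ("heads") of its edges are distinct; expanding edge by edge then factorises
-- IF(G,t) = Σ (-1)^|S| t^(n-|S|) over such S into ∏_v (t - d(v)).
-- Colouring greedily in the vertex order, v always has at least t - d(v) free colours, and exactly
-- that many for every proper colouring of its predecessors when its earlier neighbours form a clique;
-- so a perfect elimination ordering gives P(G,t) = ∏_v (t - d(v)). Conversely, if two earlier
-- neighbours j, k of i are not adjacent, a proper n-colouring giving j and k the same colour leaves i
-- an extra free colour, whence P(G,n) > ∏_v (n - d(v)) = IF(G,n).

module Submission where

open import Defs hiding (sym)
open import Data.Bool using (Bool; true; false; _∧_; _∨_; not; if_then_else_; T)
open import Data.Bool.Properties using (¬-not; T-≡; ∧-identityʳ; ∧-zeroʳ; ∨-zeroʳ; ∨-identityʳ)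
open import Data.Bool.ListAction using (all; any)
open import Data.Nat using (ℕ; zero; suc; _+_; _*_; _∸_; _^_; _≤_; _<_; z≤n; s≤s; _≤ᵇ_; _≡ᵇ_; s≤s⁻¹)
open import Data.Nat.Properties
open import Data.Nat.ListAction using (sum; product)
open import Data.Fin as Fin using (Fin; toℕ)
open import Data.Fin.Properties as Finₚ using (toℕ-injective; toℕ<n)
open import Data.List using (List; []; _∷_; _++_; allFin; concatMap; length; map; tabulate; upTo; filterᵇ)
open import Data.List.Properties
  using (++-assoc; length-++; ++-identityʳ; map-++; map-∘; length-tabulate; upTo-∷ʳ; length-removeAt′; length-map;
         ∷ʳ-injectiveˡ; ∷ʳ-injectiveʳ)
open import Data.List.Membership.Propositional using (_∈_; _∉_)
open import Data.List.Membership.Propositional.Properties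
  using (∈-allFin; ∈-tabulate⁺; ∈-filter⁺; ∈-filter⁻; ∈-∃++; ∈-++⁻; ∈-++⁺ˡ; ∈-++⁺ʳ; ∈-map⁺; ∈-map⁻;
         ∈-upTo⁺; ∈-upTo⁻)
open import Data.List.Relation.Unary.Any as Any using (Any; here; there)
open import Data.List.Relation.Unary.All as All using (All)
open import Data.List.Relation.Unary.All.Properties using (¬Any⇒All¬)
import Data.List.Relation.Unary.AllPairs as AllPairs
import Data.List.Relation.Unary.AllPairs.Properties as AllPairsₚ
open import Data.List.Relation.Unary.Unique.Propositional using (Unique)
open import Data.List.Relation.Unary.Unique.Propositional.Properties
  using (allFin⁺; filter⁺; concat⁺; Unique[x∷xs]⇒x∉xs)
open import Data.Vec as Vec using (Vec; lookup)
open import Data.Product using (Σ; _×_; _,_; proj₁; proj₂)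
open import Data.Sum using (_⊎_; inj₁; inj₂; [_,_]; [_,_]′)
open import Data.List.Extrema.Nat using (argmin; argmin-sel; f[argmin]≤f[xs])
open import Data.Empty using (⊥; ⊥-elim)
open import Data.Unit using (⊤; tt)
open import Function using (_∘_; id; case_of_; Equivalence)
open import Function.Bundles using (_⇔_; mk⇔)
open import Relation.Nullary using (¬_; yes; no)
open import Relation.Binary using (Tri; tri<; tri≈; tri>)
open import Relation.Binary.PropositionalEquality hiding ([_])
open import Data.Integer as ℤ using (ℤ; +_; -_) renaming (_+_ to _+ℤ_; _*_ to _*ℤ_; _-_ to _-ℤ_)
import Data.Integer.Properties as ℤₚ
open import Data.Integer.Tactic.RingSolver using (solve-∀)

true≢false : true ≢ false
true≢false ()

∧-elimˡ : ∀ {a b} → a ∧ b ≡ true → a ≡ true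
∧-elimˡ {true} _ = refl

∧-elimʳ : ∀ {a b} → a ∧ b ≡ true → b ≡ true
∧-elimʳ {true} e = e

∧-intro : ∀ {a b} → a ≡ true → b ≡ true → a ∧ b ≡ true
∧-intro refl refl = refl

∨-elim : ∀ {a b} → a ∨ b ≡ true → a ≡ true ⊎ b ≡ true
∨-elim {true}  _ = inj₁ refl
∨-elim {false} e = inj₂ e

∨-introˡ : ∀ {a} b → a ≡ true → a ∨ b ≡ true
∨-introˡ b refl = refl

∨-introʳ : ∀ a {b} → b ≡ true → a ∨ b ≡ true
∨-introʳ true  _ = refl
∨-introʳ false e = e

not-elim : ∀ {a} → not a ≡ true → a ≡ false
not-elim {false} _ = refl

not-intro : ∀ {a} → a ≡ false → not a ≡ true
not-intro refl = refl

⇒-elim : ∀ {a b} → not a ∨ b ≡ true → a ≡ true → b ≡ true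
⇒-elim {true} e refl = e

⇒-intro : ∀ a {b} → (a ≡ true → b ≡ true) → not a ∨ b ≡ true
⇒-intro true  h = h refl
⇒-intro false h = refl

T⇒≡true : ∀ {a} → T a → a ≡ true
T⇒≡true = Equivalence.to T-≡

≡true⇒T : ∀ {a} → a ≡ true → T a
≡true⇒T = Equivalence.from T-≡

≡ᵇ-true⇒≡ : ∀ {m n} → (m ≡ᵇ n) ≡ true → m ≡ n
≡ᵇ-true⇒≡ {m} {n} e = ≡ᵇ⇒≡ m n (≡true⇒T e)

≡⇒≡ᵇ-true : ∀ {m n} → m ≡ n → (m ≡ᵇ n) ≡ true
≡⇒≡ᵇ-true {m} {n} e = T⇒≡true (≡⇒≡ᵇ m n e)

≢⇒≡ᵇ-false : ∀ {m n} → m ≢ n → (m ≡ᵇ n) ≡ false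
≢⇒≡ᵇ-false h = ¬-not (h ∘ ≡ᵇ-true⇒≡)

≤ᵇ-true⇒≤ : ∀ {m n} → (m ≤ᵇ n) ≡ true → m ≤ n
≤ᵇ-true⇒≤ {m} {n} e = ≤ᵇ⇒≤ m n (≡true⇒T e)

≤⇒≤ᵇ-true : ∀ {m n} → m ≤ n → (m ≤ᵇ n) ≡ true
≤⇒≤ᵇ-true h = T⇒≡true (≤⇒≤ᵇ h)

==-true⇒≡ : ∀ {n} {u v : Fin n} → u == v ≡ true → u ≡ v
==-true⇒≡ e = toℕ-injective (≡ᵇ-true⇒≡ e)

==-refl : ∀ {n} (u : Fin n) → u == u ≡ true
==-refl u = ≡⇒≡ᵇ-true {toℕ u} refl

≢⇒==-false : ∀ {n} {u v : Fin n} → u ≢ v → u == v ≡ false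
≢⇒==-false h = ¬-not (h ∘ ==-true⇒≡)

<ᵛ-true⇒< : ∀ {n} {u v : Fin n} → u <ᵛ v ≡ true → toℕ u < toℕ v
<ᵛ-true⇒< = ≤ᵇ-true⇒≤

<⇒<ᵛ-true : ∀ {n} {u v : Fin n} → toℕ u < toℕ v → u <ᵛ v ≡ true
<⇒<ᵛ-true = ≤⇒≤ᵇ-true

≮⇒<ᵛ-false : ∀ {n} {u v : Fin n} → ¬ toℕ u < toℕ v → u <ᵛ v ≡ false
≮⇒<ᵛ-false h = ¬-not (h ∘ <ᵛ-true⇒<)

module _ {A : Set} where

  any⁺ : ∀ (p : A → Bool) {x xs} → x ∈ xs → p x ≡ true → any p xs ≡ true
  any⁺ p {xs = y ∷ xs} (here refl) e = ∨-introˡ (any p xs) e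
  any⁺ p {xs = y ∷ xs} (there m)   e = ∨-introʳ (p y) (any⁺ p m e)

  any⁻ : ∀ (p : A → Bool) xs → any p xs ≡ true → Σ A λ x → x ∈ xs × p x ≡ true
  any⁻ p (y ∷ xs) e with ∨-elim {p y} e
  ... | inj₁ h = y , here refl , h
  ... | inj₂ h with x , m , q ← any⁻ p xs h = x , there m , q

  all⁺ : ∀ (p : A → Bool) xs → (∀ x → x ∈ xs → p x ≡ true) → all p xs ≡ true
  all⁺ p []       h = refl
  all⁺ p (y ∷ xs) h = ∧-intro (h y (here refl)) (all⁺ p xs (λ x → h x ∘ there))

  all⁻ : ∀ (p : A → Bool) xs → all p xs ≡ true → ∀ {x} → x ∈ xs → p x ≡ true
  all⁻ p (y ∷ xs) e (here refl) = ∧-elimˡ e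
  all⁻ p (y ∷ xs) e (there m)   = all⁻ p xs (∧-elimʳ {p y} e) m

  all-false⁻ : ∀ (p : A → Bool) xs → all p xs ≡ false → Σ A λ x → x ∈ xs × p x ≡ false
  all-false⁻ p (y ∷ xs) e with p y in eq
  ... | false = y , here refl , eq
  ... | true with x , m , q ← all-false⁻ p xs e = x , there m , q

  none⇒any-false : ∀ (p : A → Bool) xs → (∀ x → x ∈ xs → p x ≡ false) → any p xs ≡ false
  none⇒any-false p xs h = ¬-not λ e → let (x , m , q) = any⁻ p xs e in true≢false (trans (sym q) (h x m))

  all-cong : ∀ (p q : A → Bool) xs → (∀ x → p x ≡ q x) → all p xs ≡ all q xs
  all-cong p q []       h = refl
  all-cong p q (x ∷ xs) h = cong₂ _∧_ (h x) (all-cong p q xs h)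

  count-cong : ∀ (p q : A → Bool) xs → (∀ x → x ∈ xs → p x ≡ q x) → count p xs ≡ count q xs
  count-cong p q []       h = refl
  count-cong p q (x ∷ xs) h rewrite h x (here refl) = cong₂ _+_ refl (count-cong p q xs (λ y → h y ∘ there))

  count-++ : ∀ (p : A → Bool) xs ys → count p (xs ++ ys) ≡ count p xs + count p ys
  count-++ p []       ys = refl
  count-++ p (x ∷ xs) ys rewrite count-++ p xs ys = sym (+-assoc (if p x then 1 else 0) _ _)

  count≡0 : ∀ (p : A → Bool) xs → (∀ x → x ∈ xs → p x ≡ false) → count p xs ≡ 0
  count≡0 p []       h = refl
  count≡0 p (x ∷ xs) h rewrite h x (here refl) = count≡0 p xs (λ y → h y ∘ there)

  count-mono : ∀ (p q : A → Bool) xs → (∀ x → p x ≡ true → q x ≡ true) → count p xs ≤ count q xs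
  count-mono p q []       h = z≤n
  count-mono p q (x ∷ xs) h with p x in e
  ... | true rewrite h x e = s≤s (count-mono p q xs h)
  ... | false = ≤-trans (count-mono p q xs h) (m≤n+m _ (if q x then 1 else 0))

  count≤length : ∀ (p : A → Bool) xs → count p xs ≤ length xs
  count≤length p []       = z≤n
  count≤length p (x ∷ xs) with p x
  ... | true  = s≤s (count≤length p xs)
  ... | false = m≤n⇒m≤1+n (count≤length p xs)

  count<length : ∀ (p : A → Bool) xs {x} → x ∈ xs → p x ≡ false → count p xs < length xs
  count<length p (y ∷ xs) (here refl) e rewrite e = s≤s (count≤length p xs)
  count<length p (y ∷ xs) (there m) e with p y
  ... | true  = s≤s (count<length p xs m e)
  ... | false = m≤n⇒m≤1+n (count<length p xs m e)

  count-true : ∀ (xs : List A) → count (λ _ → true) xs ≡ length xs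
  count-true []       = refl
  count-true (x ∷ xs) = cong suc (count-true xs)

  count-partition : ∀ (q r : A → Bool) xs →
    count (λ c → not (q c) ∧ r c) xs + count (λ c → q c ∧ r c) xs ≡ count r xs
  count-partition q r [] = refl
  count-partition q r (x ∷ xs) with q x | r x
  ... | true  | true  = trans (+-suc _ _) (cong suc (count-partition q r xs))
  ... | true  | false = count-partition q r xs
  ... | false | true  = cong suc (count-partition q r xs)
  ... | false | false = count-partition q r xs

  length-filterᵇ : ∀ (p : A → Bool) xs → length (filterᵇ p xs) ≡ count p xs
  length-filterᵇ p []       = refl
  length-filterᵇ p (x ∷ xs) with p x
  ... | true  = cong suc (length-filterᵇ p xs)
  ... | false = length-filterᵇ p xs

  ∈-filterᵇ⁺ : ∀ (p : A → Bool) {x xs} → x ∈ xs → p x ≡ true → x ∈ filterᵇ p xs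
  ∈-filterᵇ⁺ p m e = ∈-filter⁺ (Data.Bool.T? ∘ p) m (≡true⇒T e)

  ∈-filterᵇ⁻ : ∀ (p : A → Bool) {x xs} → x ∈ filterᵇ p xs → x ∈ xs × p x ≡ true
  ∈-filterᵇ⁻ p m = let (m′ , t) = ∈-filter⁻ (Data.Bool.T? ∘ p) m in m′ , T⇒≡true t

  all-implies≡all-filterᵇ : ∀ (P Q : A → Bool) xs → all (λ u → not (P u) ∨ Q u) xs ≡ all Q (filterᵇ P xs)
  all-implies≡all-filterᵇ P Q []       = refl
  all-implies≡all-filterᵇ P Q (x ∷ xs) with P x
  ... | true  = cong (Q x ∧_) (all-implies≡all-filterᵇ P Q xs)
  ... | false = all-implies≡all-filterᵇ P Q xs

  sum-cong : ∀ (f g : A → ℕ) xs → (∀ x → x ∈ xs → f x ≡ g x) → sum (map f xs) ≡ sum (map g xs)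
  sum-cong f g []       h = refl
  sum-cong f g (x ∷ xs) h = cong₂ _+_ (h x (here refl)) (sum-cong f g xs (λ y → h y ∘ there))

  sum-mono-≤ : ∀ (f g : A → ℕ) xs → (∀ x → x ∈ xs → f x ≤ g x) → sum (map f xs) ≤ sum (map g xs)
  sum-mono-≤ f g []       h = z≤n
  sum-mono-≤ f g (x ∷ xs) h = +-mono-≤ (h x (here refl)) (sum-mono-≤ f g xs (λ y → h y ∘ there))

  sum-mono-< : ∀ (f g : A → ℕ) xs {x} → x ∈ xs → (∀ y → y ∈ xs → f y ≤ g y) → f x < g x →
    sum (map f xs) < sum (map g xs)
  sum-mono-< f g (y ∷ xs) (here refl) h hx = +-mono-≤ hx (sum-mono-≤ f g xs (λ z → h z ∘ there))
  sum-mono-< f g (y ∷ xs) (there m)   h hx = subst (_≤ sum (map g (y ∷ xs))) (+-suc (f y) _)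
    (+-mono-≤ (h y (here refl)) (sum-mono-< f g xs m (λ z → h z ∘ there) hx))

  sum-if≡count* : ∀ (p : A → Bool) (r : ℕ) xs → sum (map (λ x → if p x then r else 0) xs) ≡ count p xs * r
  sum-if≡count* p r []       = refl
  sum-if≡count* p r (x ∷ xs) with p x
  ... | true  = cong (λ z → r + z) (sum-if≡count* p r xs)
  ... | false = sum-if≡count* p r xs

module _ {A B : Set} where

  count-map : ∀ (p : B → Bool) (f : A → B) xs → count p (map f xs) ≡ count (p ∘ f) xs
  count-map p f []       = refl
  count-map p f (x ∷ xs) = cong₂ _+_ refl (count-map p f xs)

  count-concatMap : ∀ (p : B → Bool) (f : A → List B) xs →
    count p (concatMap f xs) ≡ sum (map (λ x → count p (f x)) xs)
  count-concatMap p f []       = refl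
  count-concatMap p f (x ∷ xs) = trans (count-++ p (f x) (concatMap f xs)) (cong₂ _+_ refl (count-concatMap p f xs))

  ∈-concatMap⁺ : ∀ (f : A → List B) {x xs y} → x ∈ xs → y ∈ f x → y ∈ concatMap f xs
  ∈-concatMap⁺ f {xs = x ∷ xs}  (here refl) m = ∈-++⁺ˡ m
  ∈-concatMap⁺ f {xs = x′ ∷ xs} (there mx)  m = ∈-++⁺ʳ (f x′) (∈-concatMap⁺ f mx m)

  ∈-concatMap⁻ : ∀ (f : A → List B) xs {y} → y ∈ concatMap f xs → Σ A λ x → x ∈ xs × y ∈ f x
  ∈-concatMap⁻ f (x ∷ xs) m with ∈-++⁻ (f x) m
  ... | inj₁ m′ = x , here refl , m′
  ... | inj₂ m′ = let (z , a , b) = ∈-concatMap⁻ f xs m′ in z , there a , b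

  Unique-concatMap : ∀ (f : A → List B) {xs} → Unique xs → (∀ x → Unique (f x)) →
    (∀ {x y e} → e ∈ f x → e ∈ f y → x ≡ y) → Unique (concatMap f xs)
  Unique-concatMap f u uf disjoint =
    concat⁺ (All.tabulate λ m → case ∈-map⁻ f m of λ where (x , _ , refl) → uf x)
            (AllPairsₚ.map⁺ (AllPairs.map (λ x≢y {_} (ex , ey) → x≢y (disjoint ex ey)) u))

∈-─ : ∀ {A : Set} {x z : A} {ys} (m : x ∈ ys) → z ∈ ys → z ≢ x → z ∈ (ys Any.─ m)
∈-─ (here refl) (here refl) z≢x = ⊥-elim (z≢x refl)
∈-─ (here refl) (there mz)  _   = mz
∈-─ (there m)   (here refl) _   = here refl
∈-─ (there m)   (there mz)  z≢x = there (∈-─ m mz z≢x)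

Unique-length≤ : ∀ {A : Set} {xs ys : List A} → Unique xs → (∀ {x} → x ∈ xs → x ∈ ys) → length xs ≤ length ys
Unique-length≤ {xs = []}                _                   _   = z≤n
Unique-length≤ {xs = x ∷ xs} {ys} (x∉ AllPairs.∷ u) sub =
  subst (suc (length xs) ≤_) (sym (length-removeAt′ ys (Any.index x∈ys)))
    (s≤s (Unique-length≤ u λ m → ∈-─ x∈ys (sub (there m)) λ z≡x → All.lookup x∉ m (sym z≡x)))
  where
  x∈ys = sub (here refl)

count-tabulate : ∀ {A : Set} {n} (p : A → Bool) (f : Fin n → A) → count p (tabulate f) ≡ count (p ∘ f) (allFin n)
count-tabulate {n = zero}  p f = refl
count-tabulate {n = suc n} p f = cong₂ _+_ refl (trans (count-tabulate p (f ∘ Fin.suc)) (sym (count-tabulate (p ∘ f) Fin.suc)))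

length-allFin : ∀ n → length (allFin n) ≡ n
length-allFin n = length-tabulate id

count-pick : ∀ {n} (c : Fin n → Bool) {vs} v → Unique vs → v ∈ vs → count (λ w → (w == v) ∧ c w) vs ≡ (if c v then 1 else 0)
count-pick c {x ∷ vs} v (x∉ AllPairs.∷ u) (here refl) rewrite ==-refl x =
  trans (cong₂ _+_ refl (count≡0 _ vs (λ w m → cong (_∧ c w) (≢⇒==-false (All.lookup x∉ m ∘ sym)))))
        (+-identityʳ _)
count-pick c {x ∷ vs} v (x∉ AllPairs.∷ u) (there m) rewrite ≢⇒==-false {u = x} {v} (All.lookup x∉ m) =
  count-pick c v u m

prodℤ : List ℤ → ℤ
prodℤ = Data.List.foldr _*ℤ_ (+ 1)

+∸≡- : ∀ {m n} → n ≤ m → + (m ∸ n) ≡ + m -ℤ + n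
+∸≡- {m} {n} n≤m = sym (trans (ℤₚ.m-n≡m⊖n m n) (ℤₚ.⊖-≥ n≤m))

m+n≡o⇒+m≡+o-+n : ∀ {m n o} → m + n ≡ o → + m ≡ + o -ℤ + n
m+n≡o⇒+m≡+o-+n {m} {n} refl = trans (cong +_ (sym (m+n∸n≡m m n))) (+∸≡- (m≤n+m n m))

sumℤ-++ : ∀ xs ys → sumℤ (xs ++ ys) ≡ sumℤ xs +ℤ sumℤ ys
sumℤ-++ []       ys = sym (ℤₚ.+-identityˡ _)
sumℤ-++ (x ∷ xs) ys = trans (cong (x +ℤ_) (sumℤ-++ xs ys)) (sym (ℤₚ.+-assoc x _ _))

module _ {A : Set} where

  +-sum : ∀ (g : A → ℕ) xs → + sum (map g xs) ≡ sumℤ (map (+_ ∘ g) xs)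
  +-sum g []       = refl
  +-sum g (x ∷ xs) = trans (ℤₚ.pos-+ (g x) _) (cong (+ g x +ℤ_) (+-sum g xs))

  +-product : ∀ (g : A → ℕ) xs → + product (map g xs) ≡ prodℤ (map (+_ ∘ g) xs)
  +-product g []       = refl
  +-product g (x ∷ xs) = trans (ℤₚ.pos-* (g x) _) (cong (+ g x *ℤ_) (+-product g xs))

  sumℤ-cong : ∀ (f g : A → ℤ) xs → (∀ x → x ∈ xs → f x ≡ g x) → sumℤ (map f xs) ≡ sumℤ (map g xs)
  sumℤ-cong f g []       h = refl
  sumℤ-cong f g (x ∷ xs) h = cong₂ _+ℤ_ (h x (here refl)) (sumℤ-cong f g xs (λ y → h y ∘ there))

  prodℤ-cong : ∀ (f g : A → ℤ) xs → (∀ x → x ∈ xs → f x ≡ g x) → prodℤ (map f xs) ≡ prodℤ (map g xs)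
  prodℤ-cong f g []       h = refl
  prodℤ-cong f g (x ∷ xs) h = cong₂ _*ℤ_ (h x (here refl)) (prodℤ-cong f g xs (λ y → h y ∘ there))

  sumℤ≡0 : ∀ (f : A → ℤ) xs → (∀ x → x ∈ xs → f x ≡ + 0) → sumℤ (map f xs) ≡ + 0
  sumℤ≡0 f []       h = refl
  sumℤ≡0 f (x ∷ xs) h = cong₂ _+ℤ_ (h x (here refl)) (sumℤ≡0 f xs (λ y → h y ∘ there))

  sumℤ-neg : ∀ (f : A → ℤ) xs → sumℤ (map (-_ ∘ f) xs) ≡ - sumℤ (map f xs)
  sumℤ-neg f []       = refl
  sumℤ-neg f (x ∷ xs) = trans (cong (- f x +ℤ_) (sumℤ-neg f xs)) (sym (ℤₚ.neg-distrib-+ (f x) _))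

  sumℤ-if≡count* : ∀ (p : A → Bool) (r : ℤ) xs →
    sumℤ (map (λ x → if p x then r else + 0) xs) ≡ + count p xs *ℤ r
  sumℤ-if≡count* p r []       = refl
  sumℤ-if≡count* p r (x ∷ xs) with p x
  ... | true  = trans (cong (r +ℤ_) (sumℤ-if≡count* p r xs)) (suc* (+ count p xs) r)
    where
    suc* : ∀ c r → r +ℤ c *ℤ r ≡ (+ 1 +ℤ c) *ℤ r
    suc* = solve-∀
  ... | false = trans (ℤₚ.+-identityˡ _) (sumℤ-if≡count* p r xs)

sumℤ-swap : ∀ {A B : Set} (h : A → B → ℤ) xs ys →
  sumℤ (map (λ x → sumℤ (map (h x) ys)) xs) ≡ sumℤ (map (λ y → sumℤ (map (λ x → h x y) xs)) ys)
sumℤ-swap h []       ys = sym (sumℤ≡0 _ ys (λ _ _ → refl))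
sumℤ-swap h (x ∷ xs) ys = trans (cong (sumℤ (map (h x) ys) +ℤ_) (sumℤ-swap h xs ys)) (sym (sumℤ-+ ys))
  where
  sumℤ-+ : ∀ ys → sumℤ (map (λ y → h x y +ℤ sumℤ (map (λ x′ → h x′ y) xs)) ys) ≡
                  sumℤ (map (h x) ys) +ℤ sumℤ (map (λ y → sumℤ (map (λ x′ → h x′ y) xs)) ys)
  sumℤ-+ []       = refl
  sumℤ-+ (y ∷ ys) = trans (cong (h x y +ℤ sumℤ (map (λ x′ → h x′ y) xs) +ℤ_) (sumℤ-+ ys)) (interchange (h x y) _ _ _)
    where
    interchange : ∀ a b c d → (a +ℤ b) +ℤ (c +ℤ d) ≡ (a +ℤ c) +ℤ (b +ℤ d)
    interchange = solve-∀

prodℤ-pick : ∀ {n} (f : Fin n → ℤ) {vs} b → Unique vs → b ∈ vs →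
  prodℤ (map f vs) ≡ f b *ℤ prodℤ (map (λ v → if v == b then + 1 else f v) vs)
prodℤ-pick f {x ∷ vs} b (x∉ AllPairs.∷ u) (here refl) rewrite ==-refl x =
  cong (f x *ℤ_) (trans (prodℤ-cong _ _ vs (λ v m →
                          cong (λ z → if z then + 1 else f v) (sym (≢⇒==-false (All.lookup x∉ m ∘ sym)))))
                        (sym (ℤₚ.*-identityˡ _)))
prodℤ-pick f {x ∷ vs} b (x∉ AllPairs.∷ u) (there m) rewrite ≢⇒==-false {u = x} {b} (All.lookup x∉ m) =
  trans (cong (f x *ℤ_) (prodℤ-pick f b u m)) (swap (f x) (f b) _)
  where
  swap : ∀ a b c → a *ℤ (b *ℤ c) ≡ b *ℤ (a *ℤ c)
  swap = solve-∀

sumℤ-upTo-δ : ∀ (w : ℕ → ℤ) {ℓ} N → ℓ < N → sumℤ (map (λ k → if ℓ ≡ᵇ k then w k else + 0) (upTo N)) ≡ w ℓ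
sumℤ-upTo-δ w {ℓ} (suc N) ℓ<1+N = begin
  sumℤ (map δ (upTo (suc N)))            ≡⟨ cong (sumℤ ∘ map δ) (upTo-∷ʳ N) ⟨
  sumℤ (map δ (upTo N ++ N ∷ []))        ≡⟨ cong sumℤ (map-++ δ (upTo N) (N ∷ [])) ⟩
  sumℤ (map δ (upTo N) ++ δ N ∷ [])      ≡⟨ sumℤ-++ (map δ (upTo N)) (δ N ∷ []) ⟩
  sumℤ (map δ (upTo N)) +ℤ (δ N +ℤ + 0)  ≡⟨ split (m<1+n⇒m<n∨m≡n ℓ<1+N) ⟩
  w ℓ                                    ∎
  where
  open ≡-Reasoning
  δ : ℕ → ℤ
  δ k = if ℓ ≡ᵇ k then w k else + 0
  split : ℓ < N ⊎ ℓ ≡ N → sumℤ (map δ (upTo N)) +ℤ (δ N +ℤ + 0) ≡ w ℓ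
  split (inj₁ ℓ<N) rewrite sumℤ-upTo-δ w N ℓ<N | ≢⇒≡ᵇ-false (<⇒≢ ℓ<N) = ℤₚ.+-identityʳ (w ℓ)
  split (inj₂ refl) rewrite ≡⇒≡ᵇ-true {ℓ} refl
    | sumℤ≡0 δ (upTo ℓ) (λ k m → cong (λ b → if b then w k else + 0) (≢⇒≡ᵇ-false (<⇒≢ (∈-upTo⁻ m) ∘ sym)))
    = trans (ℤₚ.+-identityˡ _) (ℤₚ.+-identityʳ (w ℓ))

isLowerNeighbour : ∀ {n} → Graph n → Fin n → Fin n → Bool
isLowerNeighbour G v u = (u <ᵛ v) ∧ adj G u v

lowerDegree : ∀ {n} → Graph n → Fin n → ℕ
lowerDegree {n} G v = count (isLowerNeighbour G v) (allFin n)

lowerNeighbours : ∀ {n} → Graph n → Fin n → List (Fin n)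
lowerNeighbours {n} G v = filterᵇ (isLowerNeighbour G v) (allFin n)

∈-lowerNeighbours⁻ : ∀ {n} (G : Graph n) {u v} → u ∈ lowerNeighbours G v → toℕ u < toℕ v × adj G u v ≡ true
∈-lowerNeighbours⁻ G {u} {v} m =
  let (_ , e) = ∈-filterᵇ⁻ (isLowerNeighbour G v) {xs = allFin _} m
  in <ᵛ-true⇒< {u = u} {v} (∧-elimˡ e) , ∧-elimʳ {u <ᵛ v} e

∈-lowerNeighbours⁺ : ∀ {n} (G : Graph n) {u v} → toℕ u < toℕ v → adj G u v ≡ true → u ∈ lowerNeighbours G v
∈-lowerNeighbours⁺ G {u} {v} u<v a = ∈-filterᵇ⁺ (isLowerNeighbour G v) (∈-allFin u) (∧-intro (<⇒<ᵛ-true {u = u} {v} u<v) a)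

lowerDegree<n : ∀ {n} (G : Graph n) v → lowerDegree G v < n
lowerDegree<n {n} G v = subst (lowerDegree G v <_) (length-allFin n)
  (count<length (isLowerNeighbour G v) (allFin n) (∈-allFin v) (cong (_∧ adj G v v) (≮⇒<ᵛ-false {u = v} {v} (<-irrefl refl))))

-- the colour of the vertex with index k, as a number; 0 past the end of the list
colourAt : ∀ {t} → List (Fin t) → ℕ → ℕ
colourAt []      k       = 0
colourAt (c ∷ l) zero    = toℕ c
colourAt (c ∷ l) (suc k) = colourAt l k

colourAt-toList : ∀ {t m} (c : Vec (Fin t) m) (u : Fin m) → colourAt (Vec.toList c) (toℕ u) ≡ toℕ (lookup c u)
colourAt-toList (x Vec.∷ c) Fin.zero    = refl
colourAt-toList (x Vec.∷ c) (Fin.suc u) = colourAt-toList c u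

colourAt-++ : ∀ {t} (p s : List (Fin t)) {k} → k < length p → colourAt (p ++ s) k ≡ colourAt p k
colourAt-++ (c ∷ p) s {zero}  h       = refl
colourAt-++ (c ∷ p) s {suc k} (s≤s h) = colourAt-++ p s h

colourAt-< : ∀ {t} (p : List (Fin t)) {k} → k < length p → colourAt p k < t
colourAt-< (c ∷ p) {zero}  h       = toℕ<n c
colourAt-< (c ∷ p) {suc k} (s≤s h) = colourAt-< p h

length-∷ʳ : ∀ {A : Set} (p : List A) c → length (p ++ c ∷ []) ≡ suc (length p)
length-∷ʳ p c = trans (length-++ p) (+-comm (length p) 1)

colourAt-last : ∀ {t} (p : List (Fin t)) c → colourAt (p ++ c ∷ []) (length p) ≡ toℕ c
colourAt-last []      c = refl
colourAt-last (x ∷ p) c = colourAt-last p c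

colourAt-∷ʳ : ∀ {t} (p : List (Fin t)) c {k} → k < length (p ++ c ∷ []) →
  (k < length p × colourAt (p ++ c ∷ []) k ≡ colourAt p k) ⊎ (k ≡ length p × colourAt (p ++ c ∷ []) k ≡ toℕ c)
colourAt-∷ʳ p c {k} h with m≤n⇒m<n∨m≡n (s≤s⁻¹ (subst (k <_) (length-∷ʳ p c) h))
... | inj₁ k<p = inj₁ (k<p , colourAt-++ p (c ∷ []) k<p)
... | inj₂ refl = inj₂ (refl , colourAt-last p c)

count-toList : ∀ {t} (Q : List (Fin t) → Bool) m → count (Q ∘ Vec.toList) (allVecs t m) ≡ count Q (seqs t m)
count-toList Q zero = refl
count-toList {t} Q (suc m) =
  trans (count-concatMap _ (λ c → map (c Vec.∷_) (allVecs t m)) (allFin t))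
  (trans (sum-cong _ _ (allFin t) (λ c _ →
      trans (count-map _ (c Vec.∷_) (allVecs t m))
     (trans (count-toList (Q ∘ (c ∷_)) m)
            (sym (count-map Q (c ∷_) (seqs t m))))))
   (sym (count-concatMap Q (λ c → map (c ∷_) (seqs t m)) (allFin t))))

module Colouring {n : ℕ} (G : Graph n) (t : ℕ) where

  properList : List (Fin t) → Bool
  properList l = all (λ u → all (λ v → not (adj G u v) ∨ not (colourAt l (toℕ u) ≡ᵇ colourAt l (toℕ v))) (allFin n)) (allFin n)

  chromatic≡count-properList : chromatic G t ≡ count properList (seqs t n)
  chromatic≡count-properList = trans (count-cong _ _ (allVecs t n) (λ c _ →
      all-cong _ _ (allFin n) λ u → all-cong _ _ (allFin n) λ v →
        cong₂ (λ a b → not (adj G u v) ∨ not (a ≡ᵇ b)) (sym (colourAt-toList c u)) (sym (colourAt-toList c v))))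
    (count-toList properList n)

  properList⁻ : ∀ l → properList l ≡ true → ∀ u v → adj G u v ≡ true → colourAt l (toℕ u) ≢ colourAt l (toℕ v)
  properList⁻ l e u v a same =
    true≢false (trans (sym (≡⇒≡ᵇ-true same))
      (not-elim (⇒-elim (all⁻ _ (allFin n) (all⁻ _ (allFin n) e (∈-allFin u)) (∈-allFin v)) a)))

  properList⁺ : ∀ l → (∀ u v → adj G u v ≡ true → colourAt l (toℕ u) ≢ colourAt l (toℕ v)) → properList l ≡ true
  properList⁺ l h = all⁺ _ (allFin n) λ u _ → all⁺ _ (allFin n) λ v _ →
    ⇒-intro (adj G u v) λ a → not-intro (≢⇒≡ᵇ-false (h u v a))

  ProperPrefix : List (Fin t) → Set
  ProperPrefix p = ∀ u v → toℕ u < length p → toℕ v < length p → adj G u v ≡ true →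
    colourAt p (toℕ u) ≢ colourAt p (toℕ v)

  Conflict : List (Fin t) → Set
  Conflict p = Σ (Fin n) λ u → Σ (Fin n) λ v →
    toℕ u < length p × toℕ v < length p × adj G u v ≡ true × colourAt p (toℕ u) ≡ colourAt p (toℕ v)

  extensions : List (Fin t) → ℕ → ℕ
  extensions p m = count (λ s → properList (p ++ s)) (seqs t m)

  extensions-suc : ∀ p m → extensions p (suc m) ≡ sum (map (λ c → extensions (p ++ c ∷ []) m) (allFin t))
  extensions-suc p m = trans (count-concatMap _ (λ c → map (c ∷_) (seqs t m)) (allFin t))
    (sum-cong _ _ (allFin t) λ c _ → trans (count-map _ (c ∷_) (seqs t m))
      (count-cong _ _ (seqs t m) λ s _ → cong properList (sym (++-assoc p (c ∷ []) s))))

  extensions-conflict : ∀ p m → Conflict p → extensions p m ≡ 0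
  extensions-conflict p m (u , v , hu , hv , a , same) = count≡0 _ (seqs t m) λ s _ →
    ¬-not λ e → properList⁻ (p ++ s) e u v a
      (trans (colourAt-++ p s hu) (trans same (sym (colourAt-++ p s hv))))

  extensions-complete : ∀ p → length p ≡ n → ProperPrefix p → extensions p 0 ≡ 1
  extensions-complete p refl q rewrite ++-identityʳ p
    | properList⁺ p (λ u v → q u v (toℕ<n u) (toℕ<n v)) = refl

  colourFree : List (Fin t) → Fin n → Fin t → Bool
  colourFree p v c = all (λ u → not (isLowerNeighbour G v u) ∨ not (colourAt p (toℕ u) ≡ᵇ toℕ c)) (allFin n)

  colourFree⁻ : ∀ p {v c} u → colourFree p v c ≡ true → toℕ u < toℕ v → adj G u v ≡ true → colourAt p (toℕ u) ≢ toℕ c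
  colourFree⁻ p u free u<v a same = true≢false (trans (sym (≡⇒≡ᵇ-true same))
    (not-elim (⇒-elim (all⁻ _ (allFin n) free (∈-allFin u)) (∧-intro (<⇒<ᵛ-true u<v) a))))

  ProperPrefix-∷ʳ : ∀ p v c → toℕ v ≡ length p → ProperPrefix p → colourFree p v c ≡ true →
    ProperPrefix (p ++ c ∷ [])
  ProperPrefix-∷ʳ p v c tv q free u w hu hw a
    with colourAt-∷ʳ p c hu | colourAt-∷ʳ p c hw
  ... | inj₁ (u< , cu) | inj₁ (w< , cw) = λ same → q u w u< w< a (trans (sym cu) (trans same cw))
  ... | inj₁ (u< , cu) | inj₂ (w≡ , cw) with refl ← toℕ-injective (trans w≡ (sym tv)) =
    λ same → colourFree⁻ p u free (subst (toℕ u <_) (sym tv) u<) a (trans (sym cu) (trans same cw))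
  ... | inj₂ (u≡ , cu) | inj₁ (w< , cw) with refl ← toℕ-injective (trans u≡ (sym tv)) =
    λ same → colourFree⁻ p w free (subst (toℕ w <_) (sym tv) w<) (trans (Graph.sym G w u) a)
      (trans (sym cw) (trans (sym same) cu))
  ... | inj₂ (u≡ , _) | inj₂ (w≡ , _) with refl ← toℕ-injective (trans u≡ (sym w≡)) =
    λ _ → true≢false (trans (sym a) (Graph.irrefl G u))

  conflict-∷ʳ : ∀ p v c → toℕ v ≡ length p → colourFree p v c ≡ false → Conflict (p ++ c ∷ [])
  conflict-∷ʳ p v c tv notFree
    with u , _ , e ← all-false⁻ (λ u → not (isLowerNeighbour G v u) ∨ not (colourAt p (toℕ u) ≡ᵇ toℕ c)) (allFin n) notFree
    with isLowerNeighbour G v u in lower | colourAt p (toℕ u) ≡ᵇ toℕ c in same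
  ... | true | true =
    u , v , in-∷ʳ (m<n⇒m<1+n (subst (toℕ u <_) tv u<v)) , in-∷ʳ (≤-reflexive (cong suc tv)) , ∧-elimʳ {u <ᵛ v} lower ,
    trans (colourAt-++ p (c ∷ []) (subst (toℕ u <_) tv u<v)) (trans (≡ᵇ-true⇒≡ same)
      (sym (trans (cong (colourAt (p ++ c ∷ [])) tv) (colourAt-last p c))))
    where
    u<v = <ᵛ-true⇒< {u = u} {v} (∧-elimˡ lower)
    in-∷ʳ : ∀ {k} → k < suc (length p) → k < length (p ++ c ∷ [])
    in-∷ʳ = subst (_ <_) (sym (length-∷ʳ p c))

count-≡ᵇ≤1 : ∀ t a → count (λ (c : Fin t) → a ≡ᵇ toℕ c) (allFin t) ≤ 1
count-≡ᵇ≤1 zero    a       = z≤n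
count-≡ᵇ≤1 (suc t) zero    = ≤-reflexive (cong suc
  (trans (count-tabulate (λ (c : Fin (suc t)) → 0 ≡ᵇ toℕ c) Fin.suc) (count≡0 _ (allFin t) (λ _ _ → refl))))
count-≡ᵇ≤1 (suc t) (suc a) =
  subst (_≤ 1) (sym (count-tabulate (λ (c : Fin (suc t)) → suc a ≡ᵇ toℕ c) Fin.suc)) (count-≡ᵇ≤1 t a)

count-≡ᵇ≡1 : ∀ t a → a < t → count (λ (c : Fin t) → a ≡ᵇ toℕ c) (allFin t) ≡ 1
count-≡ᵇ≡1 (suc t) zero    _       = cong suc
  (trans (count-tabulate (λ (c : Fin (suc t)) → 0 ≡ᵇ toℕ c) Fin.suc) (count≡0 _ (allFin t) (λ _ _ → refl)))
count-≡ᵇ≡1 (suc t) (suc a) (s≤s h) =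
  trans (count-tabulate (λ (c : Fin (suc t)) → suc a ≡ᵇ toℕ c) Fin.suc) (count-≡ᵇ≡1 t a h)

module FreeColours {n : ℕ} (t : ℕ) (f : Fin n → ℕ) where

  avoids : List (Fin n) → Fin t → Bool
  avoids L c = all (λ u → not (f u ≡ᵇ toℕ c)) L

  #free : List (Fin n) → ℕ
  #free L = count (avoids L) (allFin t)

  #newlyBlocked : Fin n → List (Fin n) → ℕ
  #newlyBlocked x L = count (λ c → (f x ≡ᵇ toℕ c) ∧ avoids L c) (allFin t)

  #free-∷ : ∀ x L → #free (x ∷ L) + #newlyBlocked x L ≡ #free L
  #free-∷ x L = count-partition (λ c → f x ≡ᵇ toℕ c) (avoids L) (allFin t)

  #newlyBlocked≤1 : ∀ x L → #newlyBlocked x L ≤ 1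
  #newlyBlocked≤1 x L = ≤-trans (count-mono _ _ (allFin t) (λ c → ∧-elimˡ)) (count-≡ᵇ≤1 t (f x))

  #newlyBlocked-repeat : ∀ x L {k} → k ∈ L → f x ≡ f k → #newlyBlocked x L ≡ 0
  #newlyBlocked-repeat x L mk fx≡fk = count≡0 _ (allFin t) λ c _ → ¬-not λ e →
    true≢false (trans (sym (all⁻ _ L (∧-elimʳ {f x ≡ᵇ toℕ c} e) mk))
      (cong not (≡⇒≡ᵇ-true (trans (sym fx≡fk) (≡ᵇ-true⇒≡ (∧-elimˡ e))))))

  #newlyBlocked-fresh : ∀ x L → (∀ u → u ∈ L → f u ≢ f x) → f x < t → #newlyBlocked x L ≡ 1
  #newlyBlocked-fresh x L fu≢fx fx<t =
    trans (count-cong _ _ (allFin t) (λ c _ → avoided c)) (count-≡ᵇ≡1 t (f x) fx<t)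
    where
    avoided : ∀ c → (f x ≡ᵇ toℕ c) ∧ avoids L c ≡ (f x ≡ᵇ toℕ c)
    avoided c with f x ≡ᵇ toℕ c in eq
    ... | false = refl
    ... | true  = all⁺ _ L λ u m → not-intro (≢⇒≡ᵇ-false λ fu≡c → fu≢fx u m (trans fu≡c (sym (≡ᵇ-true⇒≡ eq))))

  #free+length-∷ : ∀ x L → #free L + length L ≤ #free (x ∷ L) + length (x ∷ L)
  #free+length-∷ x L = begin
    #free L + length L                             ≡⟨ cong (_+ length L) (#free-∷ x L) ⟨
    (#free (x ∷ L) + #newlyBlocked x L) + length L ≤⟨ +-monoˡ-≤ (length L) (+-monoʳ-≤ (#free (x ∷ L)) (#newlyBlocked≤1 x L)) ⟩
    (#free (x ∷ L) + 1) + length L                 ≡⟨ +-assoc (#free (x ∷ L)) 1 (length L) ⟩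
    #free (x ∷ L) + length (x ∷ L)                 ∎
    where open ≤-Reasoning

  t≤#free+length : ∀ L → t ≤ #free L + length L
  t≤#free+length []      = ≤-reflexive (sym (trans (+-identityʳ _) (trans (count-true (allFin t)) (length-allFin t))))
  t≤#free+length (x ∷ L) = ≤-trans (t≤#free+length L) (#free+length-∷ x L)

  #free+length≡t : ∀ L → Unique L → (∀ u w → u ∈ L → w ∈ L → u ≢ w → f u ≢ f w) → (∀ u → u ∈ L → f u < t) →
    #free L + length L ≡ t
  #free+length≡t [] _ _ _ = trans (+-identityʳ _) (trans (count-true (allFin t)) (length-allFin t))
  #free+length≡t (x ∷ L) u@(_ AllPairs.∷ uL) inj range = begin
    #free (x ∷ L) + suc (length L)              ≡⟨ +-suc _ _ ⟩
    suc (#free (x ∷ L) + length L)              ≡⟨ trans suc≡+1 (cong (λ z → (#free (x ∷ L) + z) + length L) (sym fresh)) ⟩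
    (#free (x ∷ L) + #newlyBlocked x L) + length L ≡⟨ cong (_+ length L) (#free-∷ x L) ⟩
    #free L + length L
      ≡⟨ #free+length≡t L uL (λ u w mu mw → inj u w (there mu) (there mw)) (λ u → range u ∘ there) ⟩
    t                                           ∎
    where
    open ≡-Reasoning
    x∉L = Unique[x∷xs]⇒x∉xs u
    fresh : #newlyBlocked x L ≡ 1
    fresh = #newlyBlocked-fresh x L
      (λ w m → inj w x (there m) (here refl) (λ w≡x → x∉L (subst (_∈ L) w≡x m))) (range x (here refl))
    suc≡+1 : suc (#free (x ∷ L) + length L) ≡ (#free (x ∷ L) + 1) + length L
    suc≡+1 = cong (_+ length L) (+-comm 1 _)

  t<#free+length : ∀ L {j k} → j ∈ L → k ∈ L → j ≢ k → f j ≡ f k → t < #free L + length L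
  t<#free+length (x ∷ L) (here refl) (here refl) j≢k _ = ⊥-elim (j≢k refl)
  t<#free+length (x ∷ L) (here refl) (there mk) _ fj≡fk = begin-strict
    t                                           ≤⟨ t≤#free+length L ⟩
    #free L + length L                          ≡⟨ cong (_+ length L) (#free-∷ x L) ⟨
    (#free (x ∷ L) + #newlyBlocked x L) + length L
      ≡⟨ cong (λ z → (#free (x ∷ L) + z) + length L) (#newlyBlocked-repeat x L mk fj≡fk) ⟩
    (#free (x ∷ L) + 0) + length L              <⟨ +-monoˡ-< (length L) (≤-reflexive (cong suc (+-identityʳ _))) ⟩
    suc (#free (x ∷ L)) + length L              ≡⟨ +-suc (#free (x ∷ L)) (length L) ⟨
    #free (x ∷ L) + length (x ∷ L)              ∎
    where open ≤-Reasoning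
  t<#free+length (x ∷ L) (there mj) (here refl) j≢k fj≡fk =
    t<#free+length (x ∷ L) (here refl) (there mj) (j≢k ∘ sym) (sym fj≡fk)
  t<#free+length (x ∷ L) (there mj) (there mk) j≢k fj≡fk = <-≤-trans (t<#free+length L mj mk j≢k fj≡fk) (#free+length-∷ x L)

-- Greedy colouring in the vertex order

Consecutive : ∀ {n} → ℕ → List (Fin n) → Set
Consecutive k []       = ⊤
Consecutive k (v ∷ vs) = toℕ v ≡ k × Consecutive (suc k) vs

Consecutive-tabulate : ∀ {n m} k (f : Fin m → Fin n) → (∀ i → toℕ (f i) ≡ k + toℕ i) → Consecutive k (tabulate f)
Consecutive-tabulate {m = zero}  k f h = tt
Consecutive-tabulate {m = suc m} k f h = trans (h Fin.zero) (+-identityʳ k) ,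
  Consecutive-tabulate (suc k) (f ∘ Fin.suc) (λ i → trans (h (Fin.suc i)) (+-suc k (toℕ i)))

Consecutive-allFin : ∀ n → Consecutive 0 (allFin n)
Consecutive-allFin n = Consecutive-tabulate 0 id (λ i → refl)

module Greedy {n : ℕ} (G : Graph n) (t : ℕ) where
  open Colouring G t

  #freeAt : List (Fin t) → Fin n → ℕ
  #freeAt p v = count (colourFree p v) (allFin t)

  #freeAt≡#free : ∀ p v → #freeAt p v ≡ FreeColours.#free t (colourAt p ∘ toℕ) (lowerNeighbours G v)
  #freeAt≡#free p v = count-cong _ _ (allFin t) λ c _ →
    all-implies≡all-filterᵇ (isLowerNeighbour G v) (λ u → not (colourAt p (toℕ u) ≡ᵇ toℕ c)) (allFin n)

  length-lowerNeighbours : ∀ v → length (lowerNeighbours G v) ≡ lowerDegree G v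
  length-lowerNeighbours v = length-filterᵇ (isLowerNeighbour G v) (allFin n)

  t∸lowerDegree≤#freeAt : ∀ p v → t ∸ lowerDegree G v ≤ #freeAt p v
  t∸lowerDegree≤#freeAt p v = m≤n+o⇒m∸n≤o t (lowerDegree G v) (subst (t ≤_) (+-comm (#freeAt p v) _)
    (subst₂ (λ a b → t ≤ a + b) (sym (#freeAt≡#free p v)) (length-lowerNeighbours v)
      (FreeColours.t≤#free+length t (colourAt p ∘ toℕ) (lowerNeighbours G v))))

  extensions-suc-free : ∀ p v m → toℕ v ≡ length p →
    extensions p (suc m) ≡ sum (map (λ c → if colourFree p v c then extensions (p ++ c ∷ []) m else 0) (allFin t))
  extensions-suc-free p v m tv = trans (extensions-suc p m) (sum-cong _ _ (allFin t) λ c _ → onlyFree c)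
    where
    onlyFree : ∀ c → extensions (p ++ c ∷ []) m ≡ (if colourFree p v c then extensions (p ++ c ∷ []) m else 0)
    onlyFree c with colourFree p v c in free
    ... | true  = refl
    ... | false = extensions-conflict (p ++ c ∷ []) m (conflict-∷ʳ p v c tv free)

  module _ (p : List (Fin t)) (v : Fin n) (m : ℕ) (tv : toℕ v ≡ length p) where

    branch : ℕ → Fin t → ℕ
    branch r c = if colourFree p v c then r else 0

    branch-≤ : ∀ r c → (colourFree p v c ≡ true → r ≤ extensions (p ++ c ∷ []) m) →
      branch r c ≤ branch (extensions (p ++ c ∷ []) m) c
    branch-≤ r c h with colourFree p v c in free
    ... | true  = h refl
    ... | false = z≤n

    extensions-suc-≥ : ∀ r → (∀ c → colourFree p v c ≡ true → r ≤ extensions (p ++ c ∷ []) m) →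
      #freeAt p v * r ≤ extensions p (suc m)
    extensions-suc-≥ r h = begin
      #freeAt p v * r                                                ≡⟨ sum-if≡count* _ r (allFin t) ⟨
      sum (map (branch r) (allFin t))                                ≤⟨ sum-mono-≤ _ _ (allFin t) (λ c _ → branch-≤ r c (h c)) ⟩
      sum (map (λ c → branch (extensions (p ++ c ∷ []) m) c) (allFin t)) ≡⟨ extensions-suc-free p v m tv ⟨
      extensions p (suc m)                                           ∎
      where open ≤-Reasoning

    extensions-suc-> : ∀ r → (∀ c → colourFree p v c ≡ true → r ≤ extensions (p ++ c ∷ []) m) →
      ∀ c₀ → colourFree p v c₀ ≡ true → r < extensions (p ++ c₀ ∷ []) m → #freeAt p v * r < extensions p (suc m)
    extensions-suc-> r h c₀ free₀ r<e = begin-strict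
      #freeAt p v * r                                                ≡⟨ sum-if≡count* _ r (allFin t) ⟨
      sum (map (branch r) (allFin t))
        <⟨ sum-mono-< _ _ (allFin t) (∈-allFin c₀) (λ c _ → branch-≤ r c (h c)) atC₀ ⟩
      sum (map (λ c → branch (extensions (p ++ c ∷ []) m) c) (allFin t)) ≡⟨ extensions-suc-free p v m tv ⟨
      extensions p (suc m)                                           ∎
      where
      open ≤-Reasoning
      atC₀ : branch r c₀ < branch (extensions (p ++ c₀ ∷ []) m) c₀
      atC₀ rewrite free₀ = r<e

    extensions-suc-≡ : ∀ r → (∀ c → colourFree p v c ≡ true → + extensions (p ++ c ∷ []) m ≡ r) →
      + extensions p (suc m) ≡ + #freeAt p v *ℤ r
    extensions-suc-≡ r h = begin
      + extensions p (suc m)                                         ≡⟨ cong +_ (extensions-suc-free p v m tv) ⟩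
      + sum (map (λ c → branch (extensions (p ++ c ∷ []) m) c) (allFin t)) ≡⟨ +-sum _ (allFin t) ⟩
      sumℤ (map (λ c → + branch (extensions (p ++ c ∷ []) m) c) (allFin t))
        ≡⟨ sumℤ-cong _ _ (allFin t) (λ c _ → branchℤ c) ⟩
      sumℤ (map (λ c → if colourFree p v c then r else + 0) (allFin t)) ≡⟨ sumℤ-if≡count* _ r (allFin t) ⟩
      + #freeAt p v *ℤ r                                             ∎
      where
      open ≡-Reasoning
      branchℤ : ∀ c → + branch (extensions (p ++ c ∷ []) m) c ≡ (if colourFree p v c then r else + 0)
      branchℤ c with colourFree p v c in free
      ... | true  = h c free
      ... | false = refl

  -- p colours the first vertices; rest lists the others in order
  Schedule : List (Fin t) → List (Fin n) → Set
  Schedule p rest = Consecutive (length p) rest × length p + length rest ≡ n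

  schedule-∷ʳ : ∀ p c v rest → Schedule p (v ∷ rest) → Schedule (p ++ c ∷ []) rest
  schedule-∷ʳ p c v rest ((_ , cs) , len) =
    subst (λ k → Consecutive k rest) (sym (length-∷ʳ p c)) cs ,
    trans (cong (_+ length rest) (length-∷ʳ p c)) (trans (sym (+-suc _ _)) len)

  schedule-done : ∀ p → Schedule p [] → length p ≡ n
  schedule-done p (_ , len) = trans (sym (+-identityʳ _)) len

  schedule-start : Schedule [] (allFin n)
  schedule-start = Consecutive-allFin n , length-allFin n

  degreeProductℤ : List (Fin n) → ℤ
  degreeProductℤ vs = prodℤ (map (λ v → + t -ℤ + lowerDegree G v) vs)

  degreeProduct : List (Fin n) → ℕ
  degreeProduct vs = product (map (λ v → t ∸ lowerDegree G v) vs)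

  -- the earlier neighbours of v form a clique, so they carry distinct colours
  #freeAt+lowerDegree≡t : PerfectEliminationOrdering G → ∀ p v → toℕ v ≡ length p → ProperPrefix p →
    #freeAt p v + lowerDegree G v ≡ t
  #freeAt+lowerDegree≡t peo p v tv q =
    subst₂ (λ a b → a + b ≡ t) (sym (#freeAt≡#free p v)) (length-lowerNeighbours v)
      (FreeColours.#free+length≡t t (colourAt p ∘ toℕ) (lowerNeighbours G v)
        (filter⁺ _ (allFin⁺ n)) distinctColours inRange)
    where
    below : ∀ {u} → u ∈ lowerNeighbours G v → toℕ u < length p
    below m = subst (_ <_) tv (proj₁ (∈-lowerNeighbours⁻ G m))
    distinctColours : ∀ u w → u ∈ lowerNeighbours G v → w ∈ lowerNeighbours G v → u ≢ w →
      colourAt p (toℕ u) ≢ colourAt p (toℕ w)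
    distinctColours u w mu mw u≢w =
      let (u<v , au) = ∈-lowerNeighbours⁻ G mu ; (w<v , aw) = ∈-lowerNeighbours⁻ G mw
      in q u w (below mu) (below mw)
           (peo v u w u<v w<v (trans (Graph.sym G v u) au) (trans (Graph.sym G v w) aw) u≢w)
    inRange : ∀ u → u ∈ lowerNeighbours G v → colourAt p (toℕ u) < t
    inRange u m = colourAt-< p (below m)

  degreeProductℤ≡degreeProduct : (∀ v → lowerDegree G v ≤ t) → ∀ vs → degreeProductℤ vs ≡ + degreeProduct vs
  degreeProductℤ≡degreeProduct d≤t vs =
    trans (prodℤ-cong _ _ vs (λ v _ → sym (+∸≡- (d≤t v)))) (sym (+-product (λ v → t ∸ lowerDegree G v) vs))

  extensions-PEO : PerfectEliminationOrdering G → ∀ rest p → Schedule p rest → ProperPrefix p →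
    + extensions p (length rest) ≡ degreeProductℤ rest
  extensions-PEO peo [] p s q = cong +_ (extensions-complete p (schedule-done p s) q)
  extensions-PEO peo (v ∷ rest) p s@((tv , _) , _) q = begin
    + extensions p (suc (length rest)) ≡⟨ extensions-suc-≡ p v (length rest) tv (degreeProductℤ rest) (λ c free →
        extensions-PEO peo rest (p ++ c ∷ []) (schedule-∷ʳ p c v rest s) (ProperPrefix-∷ʳ p v c tv q free)) ⟩
    + #freeAt p v *ℤ degreeProductℤ rest ≡⟨ cong (_*ℤ degreeProductℤ rest)
        (m+n≡o⇒+m≡+o-+n {#freeAt p v} {lowerDegree G v} (#freeAt+lowerDegree≡t peo p v tv q)) ⟩
    (+ t -ℤ + lowerDegree G v) *ℤ degreeProductℤ rest ∎
    where open ≡-Reasoning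

  degreeProduct≤extensions : ∀ rest p → Schedule p rest → ProperPrefix p → degreeProduct rest ≤ extensions p (length rest)
  degreeProduct≤extensions [] p s q = ≤-reflexive (sym (extensions-complete p (schedule-done p s) q))
  degreeProduct≤extensions (v ∷ rest) p s@((tv , _) , _) q = begin
    (t ∸ lowerDegree G v) * degreeProduct rest ≤⟨ *-monoˡ-≤ (degreeProduct rest) (t∸lowerDegree≤#freeAt p v) ⟩
    #freeAt p v * degreeProduct rest          ≤⟨ extensions-suc-≥ p v (length rest) tv (degreeProduct rest) (λ c free →
        degreeProduct≤extensions rest (p ++ c ∷ []) (schedule-∷ʳ p c v rest s) (ProperPrefix-∷ʳ p v c tv q free)) ⟩
    extensions p (suc (length rest))          ∎
    where open ≤-Reasoning

  chromatic≡extensions : chromatic G t ≡ extensions [] (length (allFin n))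
  chromatic≡extensions = trans chromatic≡count-properList (cong (extensions []) (sym (length-allFin n)))

  chromatic-PEO : PerfectEliminationOrdering G → + chromatic G t ≡ degreeProductℤ (allFin n)
  chromatic-PEO peo = trans (cong +_ chromatic≡extensions) (extensions-PEO peo (allFin n) [] schedule-start (λ u v ()))

  -- A proper colouring κ repeating a colour on two earlier neighbours of some vertex i is counted
  -- on top of the degree product: along κ, i has one more free colour than the bound allows.
  module _ (κ : Fin n → Fin t) (κ-proper : ∀ u w → adj G u w ≡ true → κ u ≢ κ w)
           (lowerDegree<t : ∀ v → lowerDegree G v < t)
           {i j k : Fin n} (j∈ : j ∈ lowerNeighbours G i) (k∈ : k ∈ lowerNeighbours G i)
           (j≢k : j ≢ k) (κj≡κk : κ j ≡ κ k) where

    PrefixOfκ : List (Fin t) → Set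
    PrefixOfκ p = ∀ u → toℕ u < length p → colourAt p (toℕ u) ≡ toℕ (κ u)

    PrefixOfκ⇒ProperPrefix : ∀ p → PrefixOfκ p → ProperPrefix p
    PrefixOfκ⇒ProperPrefix p h u w hu hw a same =
      κ-proper u w a (toℕ-injective (trans (sym (h u hu)) (trans same (h w hw))))

    PrefixOfκ-∷ʳ : ∀ p v → toℕ v ≡ length p → PrefixOfκ p → PrefixOfκ (p ++ κ v ∷ [])
    PrefixOfκ-∷ʳ p v tv h u hu with colourAt-∷ʳ p (κ v) hu
    ... | inj₁ (u< , cu) = trans cu (h u u<)
    ... | inj₂ (u≡ , cu) with refl ← toℕ-injective (trans u≡ (sym tv)) = cu

    κ-free : ∀ p v → toℕ v ≡ length p → PrefixOfκ p → colourFree p v (κ v) ≡ true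
    κ-free p v tv h with colourFree p v (κ v) in free
    ... | true  = refl
    ... | false with u , w , hu , hw , a , same ← conflict-∷ʳ p v (κ v) tv free =
      ⊥-elim (PrefixOfκ⇒ProperPrefix (p ++ κ v ∷ []) (PrefixOfκ-∷ʳ p v tv h) u w hu hw a same)

    degreeProduct>0 : ∀ rest → 0 < degreeProduct rest
    degreeProduct>0 []         = s≤s z≤n
    degreeProduct>0 (v ∷ rest) = *-mono-≤ (m<n⇒0<n∸m (lowerDegree<t v)) (degreeProduct>0 rest)

    t∸lowerDegree<#freeAt : ∀ p → toℕ i ≡ length p → PrefixOfκ p → t ∸ lowerDegree G i < #freeAt p i
    t∸lowerDegree<#freeAt p ti h =
      subst (_≤ #freeAt p i) (+-∸-assoc 1 (<⇒≤ (lowerDegree<t i)))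
        (m≤n+o⇒m∸n≤o (suc t) (lowerDegree G i) (subst (suc t ≤_) (+-comm (#freeAt p i) _) t<#freeAt+d))
      where
      below : ∀ {u} → u ∈ lowerNeighbours G i → toℕ u < length p
      below m = subst (_ <_) ti (proj₁ (∈-lowerNeighbours⁻ G m))
      t<#freeAt+d : t < #freeAt p i + lowerDegree G i
      t<#freeAt+d = subst₂ (λ a b → t < a + b) (sym (#freeAt≡#free p i)) (length-lowerNeighbours i)
        (FreeColours.t<#free+length t (colourAt p ∘ toℕ) (lowerNeighbours G i) j∈ k∈ j≢k
          (trans (h j (below j∈)) (trans (cong toℕ κj≡κk) (sym (h k (below k∈))))))

    degreeProduct<extensions : ∀ rest p → Schedule p rest → length p ≤ toℕ i → PrefixOfκ p →
      degreeProduct rest < extensions p (length rest)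
    degreeProduct<extensions [] p s p≤i h = ⊥-elim (<⇒≱ (toℕ<n i) (subst (_≤ toℕ i) (schedule-done p s) p≤i))
    degreeProduct<extensions (v ∷ rest) p s@((tv , _) , _) p≤i h with m≤n⇒m<n∨m≡n p≤i
    ... | inj₂ p≡i with refl ← toℕ-injective (trans tv p≡i) = begin-strict
      (t ∸ lowerDegree G v) * R   <⟨ m<n+m _ (degreeProduct>0 rest) ⟩
      suc (t ∸ lowerDegree G v) * R ≤⟨ *-monoˡ-≤ R (t∸lowerDegree<#freeAt p (sym p≡i) h) ⟩
      #freeAt p v * R             ≤⟨ extensions-suc-≥ p v (length rest) tv R (λ c free →
          degreeProduct≤extensions rest (p ++ c ∷ []) (schedule-∷ʳ p c v rest s)
            (ProperPrefix-∷ʳ p v c tv (PrefixOfκ⇒ProperPrefix p h) free)) ⟩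
      extensions p (suc (length rest)) ∎
      where
      open ≤-Reasoning
      R = degreeProduct rest
    ... | inj₁ p<i = begin-strict
      (t ∸ lowerDegree G v) * R   ≤⟨ *-monoˡ-≤ R (t∸lowerDegree≤#freeAt p v) ⟩
      #freeAt p v * R             <⟨ extensions-suc-> p v (length rest) tv R
          (λ c free → degreeProduct≤extensions rest (p ++ c ∷ []) (schedule-∷ʳ p c v rest s)
            (ProperPrefix-∷ʳ p v c tv (PrefixOfκ⇒ProperPrefix p h) free))
          (κ v) (κ-free p v tv h)
          (degreeProduct<extensions rest (p ++ κ v ∷ []) (schedule-∷ʳ p (κ v) v rest s)
            (subst (_≤ toℕ i) (sym (length-∷ʳ p (κ v))) p<i) (PrefixOfκ-∷ʳ p v tv h)) ⟩
      extensions p (suc (length rest)) ∎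
      where
      open ≤-Reasoning
      R = degreeProduct rest

    degreeProduct<chromatic : degreeProduct (allFin n) < chromatic G t
    degreeProduct<chromatic = subst (degreeProduct (allFin n) <_) (sym chromatic≡extensions)
      (degreeProduct<extensions (allFin n) [] schedule-start z≤n (λ u ()))

-- Signed sums over edge sets with distinct heads

module _ {n : ℕ} where

  mark : (Fin n → Bool) → Fin n → Fin n → Bool
  mark U b v = U v ∨ (v == b)

  -- the edges of S have distinct heads, none of them marked by U
  freshHeads : (Fin n → Bool) → EdgeSet n → Bool
  freshHeads U []            = true
  freshHeads U ((a , b) ∷ S) = not (U b) ∧ freshHeads (mark U b) S

  #unmarked : (Fin n → Bool) → ℕ
  #unmarked U = count (not ∘ U) (allFin n)

  #unmarked-mark : ∀ U b → U b ≡ false → #unmarked (mark U b) + 1 ≡ #unmarked U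
  #unmarked-mark U b ub = begin
    #unmarked (mark U b) + 1                          ≡⟨ cong₂ _+_ (count-cong _ _ (allFin n) (λ v _ → deMorgan v)) (sym pickB) ⟩
    count (λ v → not (v == b) ∧ not (U v)) (allFin n) +
      count (λ v → (v == b) ∧ not (U v)) (allFin n)   ≡⟨ count-partition (_== b) (not ∘ U) (allFin n) ⟩
    #unmarked U                                       ∎
    where
    open ≡-Reasoning
    deMorgan : ∀ v → not (U v ∨ (v == b)) ≡ not (v == b) ∧ not (U v)
    deMorgan v with U v | v == b
    ... | true  | true  = refl
    ... | true  | false = refl
    ... | false | true  = refl
    ... | false | false = refl
    pickB : count (λ v → (v == b) ∧ not (U v)) (allFin n) ≡ 1
    pickB = trans (count-pick (not ∘ U) b (allFin⁺ n) (∈-allFin b)) (cong (λ z → if not z then 1 else 0) ub)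

  freshHeads⇒unmarked : ∀ U S → freshHeads U S ≡ true → ∀ {a c} → (a , c) ∈ S → U c ≡ false
  freshHeads⇒unmarked U ((a , b) ∷ S) fresh (here refl) = not-elim (∧-elimˡ fresh)
  freshHeads⇒unmarked U ((a , b) ∷ S) fresh {c = c} (there m)
    with U c | freshHeads⇒unmarked (mark U b) S (∧-elimʳ {not (U b)} fresh) m
  ... | false | _ = refl

  freshHeads⇒Unique : ∀ U S → freshHeads U S ≡ true → Unique (map proj₂ S)
  freshHeads⇒Unique U []            _     = AllPairs.[]
  freshHeads⇒Unique U ((a , b) ∷ S) fresh =
    All.tabulate (λ m → case ∈-map⁻ proj₂ m of λ where
      ((a′ , c) , m′ , refl) → λ b≡c → true≢false
        (trans (sym (∨-introʳ (U _) (subst (λ z → z == b ≡ true) b≡c (==-refl b))))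
               (freshHeads⇒unmarked (mark U b) S freshS m′)))
    AllPairs.∷ freshHeads⇒Unique (mark U b) S freshS
    where
    freshS = ∧-elimʳ {not (U b)} fresh

  headCount : Fin n → EdgeSet n → ℕ
  headCount v L = count (λ e → proj₂ e == v) L

module SignedSum {n : ℕ} (t : ℕ) where

  signedPower : ℕ → ℕ → ℤ
  signedPower m s = (- + 1) ℤ.^ s *ℤ + (t ^ (m ∸ s))

  signedPower-suc : ∀ m s → signedPower m (suc s) ≡ - signedPower (m ∸ 1) s
  signedPower-suc m s = trans (cong (λ z → (- + 1) ℤ.^ suc s *ℤ + (t ^ z)) (sym (∸-+-assoc m 1 s)))
                              (negate ((- + 1) ℤ.^ s) _)
    where
    negate : ∀ a b → (- + 1 *ℤ a) *ℤ b ≡ - (a *ℤ b)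
    negate = solve-∀

  term : (Fin n → Bool) → EdgeSet n → ℤ
  term U S = if freshHeads U S then signedPower (#unmarked U) (length S) else + 0

  freshHeadsSum : (Fin n → Bool) → EdgeSet n → ℤ
  freshHeadsSum U L = sumℤ (map (term U) (sublists L))

  factor : (Fin n → Bool) → EdgeSet n → Fin n → ℤ
  factor U L v = if U v then + 1 else + t -ℤ + headCount v L

  factorProduct : (Fin n → Bool) → EdgeSet n → ℤ
  factorProduct U L = prodℤ (map (factor U L) (allFin n))

  factorProduct-[] : ∀ U vs → prodℤ (map (factor U []) vs) ≡ + (t ^ count (not ∘ U) vs)
  factorProduct-[] U []       = refl
  factorProduct-[] U (v ∷ vs) with U v
  ... | true  = trans (ℤₚ.*-identityˡ _) (factorProduct-[] U vs)
  ... | false = trans (cong₂ _*ℤ_ (ℤₚ.+-identityʳ (+ t)) (factorProduct-[] U vs)) (sym (ℤₚ.pos-* t _))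

  freshHeadsSum-∷ : ∀ U e L → freshHeadsSum U (e ∷ L) ≡ freshHeadsSum U L +ℤ sumℤ (map (term U ∘ (e ∷_)) (sublists L))
  freshHeadsSum-∷ U e L =
    trans (cong sumℤ (map-++ (term U) (sublists L) _))
   (trans (sumℤ-++ (map (term U) (sublists L)) _)
          (cong (freshHeadsSum U L +ℤ_) (cong sumℤ (sym (map-∘ (sublists L))))))

  factor-∷-elsewhere : ∀ U L a b v → (v == b) ≡ false → factor U ((a , b) ∷ L) v ≡ factor U L v
  factor-∷-elsewhere U L a b v v≢b
    rewrite ≢⇒==-false {u = b} {v} (λ b≡v → true≢false (trans (sym (subst (λ z → z == b ≡ _) b≡v (==-refl b))) v≢b)) =
    refl

  -- expanding by the first edge (a , b): subsets avoiding it, and subsets containing it (which mark b)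
  freshHeadsSum≡factorProduct : ∀ L U → freshHeadsSum U L ≡ factorProduct U L
  freshHeadsSum≡factorProduct [] U = trans (ℤₚ.+-identityʳ _)
    (trans (ℤₚ.*-identityˡ _) (sym (factorProduct-[] U (allFin n))))
  freshHeadsSum≡factorProduct ((a , b) ∷ L) U with U b in ub
  ... | true = begin
    freshHeadsSum U ((a , b) ∷ L)                        ≡⟨ freshHeadsSum-∷ U (a , b) L ⟩
    freshHeadsSum U L +ℤ sumℤ (map (term U ∘ ((a , b) ∷_)) (sublists L))
      ≡⟨ cong (freshHeadsSum U L +ℤ_) (sumℤ≡0 _ (sublists L) (λ S _ → blocked S)) ⟩
    freshHeadsSum U L +ℤ + 0                             ≡⟨ ℤₚ.+-identityʳ _ ⟩
    freshHeadsSum U L                                    ≡⟨ freshHeadsSum≡factorProduct L U ⟩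
    factorProduct U L                                    ≡⟨ prodℤ-cong _ _ (allFin n) (λ v _ → unchanged v) ⟩
    factorProduct U ((a , b) ∷ L)                        ∎
    where
    open ≡-Reasoning
    blocked : ∀ S → term U ((a , b) ∷ S) ≡ + 0
    blocked S rewrite ub = refl
    unchanged : ∀ v → factor U L v ≡ factor U ((a , b) ∷ L) v
    unchanged v with v == b in vb
    ... | false = sym (factor-∷-elsewhere U L a b v vb)
    ... | true with refl ← ==-true⇒≡ {u = v} {b} vb rewrite ub = refl
  ... | false = begin
    freshHeadsSum U ((a , b) ∷ L)                        ≡⟨ freshHeadsSum-∷ U (a , b) L ⟩
    freshHeadsSum U L +ℤ sumℤ (map (term U ∘ ((a , b) ∷_)) (sublists L))
      ≡⟨ cong (freshHeadsSum U L +ℤ_) (trans (sumℤ-cong _ _ (sublists L) (λ S _ → marked S)) (sumℤ-neg (term U′) (sublists L))) ⟩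
    freshHeadsSum U L +ℤ - freshHeadsSum U′ L
      ≡⟨ cong₂ (λ x y → x +ℤ - y) (freshHeadsSum≡factorProduct L U) (freshHeadsSum≡factorProduct L U′) ⟩
    factorProduct U L +ℤ - factorProduct U′ L            ≡⟨ cong₂ (λ x y → x +ℤ - y) (pick U L) (pick U′ L) ⟩
    factor U L b *ℤ others U L +ℤ - (factor U′ L b *ℤ others U′ L)
      ≡⟨ cong₂ (λ x y → x *ℤ R +ℤ - y) factorB (cong₂ _*ℤ_ factorU′B othersU′) ⟩
    (+ t -ℤ + headCount b L) *ℤ R +ℤ - (+ 1 *ℤ R)         ≡⟨ ring (+ t) (+ headCount b L) R ⟨
    (+ t -ℤ (+ 1 +ℤ + headCount b L)) *ℤ R                ≡⟨ cong (_*ℤ R) (sym bFactor) ⟩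
    factor U ((a , b) ∷ L) b *ℤ R                         ≡⟨ cong (factor U ((a , b) ∷ L) b *ℤ_) othersNew ⟩
    factor U ((a , b) ∷ L) b *ℤ others U ((a , b) ∷ L)    ≡⟨ pick U ((a , b) ∷ L) ⟨
    factorProduct U ((a , b) ∷ L)                        ∎
    where
    open ≡-Reasoning
    U′ = mark U b
    others : (Fin n → Bool) → EdgeSet n → ℤ
    others V K = prodℤ (map (λ v → if v == b then + 1 else factor V K v) (allFin n))
    R = others U L
    pick : ∀ V K → factorProduct V K ≡ factor V K b *ℤ others V K
    pick V K = prodℤ-pick (factor V K) b (allFin⁺ n) (∈-allFin b)
    ring : ∀ t c r → (t -ℤ (+ 1 +ℤ c)) *ℤ r ≡ (t -ℤ c) *ℤ r +ℤ - (+ 1 *ℤ r)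
    ring = solve-∀
    factorB : factor U L b ≡ + t -ℤ + headCount b L
    factorB rewrite ub = refl
    factorU′B : factor U′ L b ≡ + 1
    factorU′B rewrite ==-refl b | ∨-zeroʳ (U b) = refl
    bFactor : factor U ((a , b) ∷ L) b ≡ + t -ℤ (+ 1 +ℤ + headCount b L)
    bFactor rewrite ub | ==-refl b = refl
    othersU′ : others U′ L ≡ R
    othersU′ = prodℤ-cong _ _ (allFin n) λ v _ → same v
      where
      same : ∀ v → (if v == b then + 1 else factor U′ L v) ≡ (if v == b then + 1 else factor U L v)
      same v with v == b in vb
      ... | true  = refl
      ... | false rewrite ∨-identityʳ (U v) = refl
    othersNew : R ≡ others U ((a , b) ∷ L)
    othersNew = prodℤ-cong _ _ (allFin n) λ v _ → same v
      where
      same : ∀ v → (if v == b then + 1 else factor U L v) ≡ (if v == b then + 1 else factor U ((a , b) ∷ L) v)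
      same v with v == b in vb
      ... | true  = refl
      ... | false = sym (factor-∷-elsewhere U L a b v vb)
    #unmarked-U′ : #unmarked U′ ≡ #unmarked U ∸ 1
    #unmarked-U′ = sym (trans (cong (_∸ 1) (sym (#unmarked-mark U b ub))) (m+n∸n≡m _ 1))
    marked : ∀ S → term U ((a , b) ∷ S) ≡ - term U′ S
    marked S rewrite ub with freshHeads U′ S
    ... | false = refl
    ... | true  = trans (signedPower-suc (#unmarked U) (length S)) (cong (λ m → - signedPower m (length S)) (sym #unmarked-U′))

module _ {A : Set} where

  sublists-⊆ : ∀ (L : List A) {S} → S ∈ sublists L → ∀ {e} → e ∈ S → e ∈ L
  sublists-⊆ []      (here refl) ()
  sublists-⊆ (x ∷ L) {S} m me with ∈-++⁻ (sublists L) m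
  ... | inj₁ m′ = there (sublists-⊆ L m′ me)
  ... | inj₂ m′ with S′ , m″ , refl ← ∈-map⁻ (x ∷_) m′ with me
  ...   | here refl = here refl
  ...   | there me′ = there (sublists-⊆ L m″ me′)

  sublists-Unique : ∀ (L : List A) {S} → Unique L → S ∈ sublists L → Unique S
  sublists-Unique []      _ (here refl) = AllPairs.[]
  sublists-Unique (x ∷ L) (x∉ AllPairs.∷ u) m with ∈-++⁻ (sublists L) m
  ... | inj₁ m′ = sublists-Unique L u m′
  ... | inj₂ m′ with S′ , m″ , refl ← ∈-map⁻ (x ∷_) m′ =
    All.tabulate (λ me → All.lookup x∉ (sublists-⊆ L m″ me)) AllPairs.∷ sublists-Unique L u m″

module Edges {n : ℕ} (G : Graph n) where

  edgeBlock : Fin n → Fin n → EdgeSet n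
  edgeBlock u w = if (u <ᵛ w) ∧ adj G u w then (u , w) ∷ [] else []

  ∈-edgeBlock⁻ : ∀ u w {e} → e ∈ edgeBlock u w → e ≡ (u , w) × toℕ u < toℕ w
  ∈-edgeBlock⁻ u w m with (u <ᵛ w) ∧ adj G u w in eq
  ∈-edgeBlock⁻ u w (here refl) | true = refl , <ᵛ-true⇒< {u = u} {w} (∧-elimˡ eq)

  Unique-edgeBlock : ∀ u w → Unique (edgeBlock u w)
  Unique-edgeBlock u w with (u <ᵛ w) ∧ adj G u w
  ... | true  = All.[] AllPairs.∷ AllPairs.[]
  ... | false = AllPairs.[]

  ∈-edges⁻ : ∀ {e} → e ∈ edges G → toℕ (proj₁ e) < toℕ (proj₂ e)
  ∈-edges⁻ m
    with u , _ , m₁ ← ∈-concatMap⁻ (λ u → concatMap (edgeBlock u) (allFin n)) (allFin n) m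
    with w , _ , m₂ ← ∈-concatMap⁻ (edgeBlock u) (allFin n) m₁
    with refl , lt ← ∈-edgeBlock⁻ u w m₂ = lt

  Unique-edges : Unique (edges G)
  Unique-edges = Unique-concatMap _ (allFin⁺ n)
    (λ u → Unique-concatMap (edgeBlock u) (allFin⁺ n) (Unique-edgeBlock u)
       (λ {w} {w′} m m′ → cong proj₂ (trans (sym (proj₁ (∈-edgeBlock⁻ u w m))) (proj₁ (∈-edgeBlock⁻ u w′ m′)))))
    (λ {u} {u′} m m′ →
       let (w , _ , m₁) = ∈-concatMap⁻ (edgeBlock u) (allFin n) m
           (w′ , _ , m₁′) = ∈-concatMap⁻ (edgeBlock u′) (allFin n) m′
       in cong proj₁ (trans (sym (proj₁ (∈-edgeBlock⁻ u w m₁))) (proj₁ (∈-edgeBlock⁻ u′ w′ m₁′))))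

  headCount-edges : ∀ v → headCount v (edges G) ≡ lowerDegree G v
  headCount-edges v = begin
    headCount v (edges G)                                      ≡⟨ count-concatMap _ _ (allFin n) ⟩
    sum (map (λ u → count isHead (concatMap (edgeBlock u) (allFin n))) (allFin n))
                                                               ≡⟨ sum-cong _ _ (allFin n) (λ u _ → fromU u) ⟩
    sum (map (λ u → if isLowerNeighbour G v u then 1 else 0) (allFin n)) ≡⟨ sum-if≡count* _ 1 (allFin n) ⟩
    lowerDegree G v * 1                                        ≡⟨ *-identityʳ _ ⟩
    lowerDegree G v                                            ∎
    where
    open ≡-Reasoning
    isHead : Fin n × Fin n → Bool
    isHead e = proj₂ e == v
    inBlock : ∀ u w → count isHead (edgeBlock u w) ≡ (if (w == v) ∧ ((u <ᵛ w) ∧ adj G u w) then 1 else 0)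
    inBlock u w with (u <ᵛ w) ∧ adj G u w
    ... | true  = trans (+-identityʳ _) (cong (λ b → if b then 1 else 0) (sym (∧-identityʳ (w == v))))
    ... | false = cong (λ b → if b then 1 else 0) (sym (∧-zeroʳ (w == v)))
    fromU : ∀ u → count isHead (concatMap (edgeBlock u) (allFin n)) ≡ (if isLowerNeighbour G v u then 1 else 0)
    fromU u = trans (count-concatMap _ _ (allFin n)) (trans (sum-cong _ _ (allFin n) (λ w _ → inBlock u w))
              (trans (sum-if≡count* _ 1 (allFin n)) (trans (*-identityʳ _)
              (count-pick (λ w → (u <ᵛ w) ∧ adj G u w) v (allFin⁺ n) (∈-allFin v)))))

  module _ {S} (S⊆E : S ∈ sublists (edges G)) where

    sublist-upward : ∀ {a b} → (a , b) ∈ S → toℕ a < toℕ b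
    sublist-upward m = ∈-edges⁻ (sublists-⊆ (edges G) S⊆E m)

    sublist-Unique : Unique S
    sublist-Unique = sublists-Unique (edges G) Unique-edges S⊆E


-- the heads are distinct and none of them is the first vertex
freshHeads⇒length< : ∀ {n} (G : Graph (suc n)) {S} → S ∈ sublists (edges G) → ∀ U → freshHeads U S ≡ true → length S < suc n
freshHeads⇒length< {n} G {S} S⊆E U fresh = s≤s (begin
  length S                         ≡⟨ length-map proj₂ S ⟨
  length (map proj₂ S)             ≤⟨ Unique-length≤ (freshHeads⇒Unique U S fresh) nonzero ⟩
  length (tabulate {n = n} Fin.suc) ≡⟨ length-tabulate Fin.suc ⟩
  n                                ∎)
  where
  open ≤-Reasoning
  nonzero : ∀ {c} → c ∈ map proj₂ S → c ∈ tabulate Fin.suc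
  nonzero m with (a , c) , m′ , refl ← ∈-map⁻ proj₂ m with c | Edges.sublist-upward G S⊆E m′
  ... | Fin.suc c′ | _ = ∈-tabulate⁺ c′

lastOr : ∀ {A : Set} → A → List A → A
lastOr d []       = d
lastOr d (x ∷ xs) = lastOr x xs

lastOr-++ : ∀ {A : Set} (d : A) xs ys → lastOr d (xs ++ ys) ≡ lastOr (lastOr d xs) ys
lastOr-++ d []       ys = refl
lastOr-++ d (x ∷ xs) ys = lastOr-++ x xs ys

module _ {n : ℕ} where

  ∈-seqs : ∀ (xs : List (Fin n)) → xs ∈ seqs n (length xs)
  ∈-seqs []       = here refl
  ∈-seqs (x ∷ xs) = ∈-concatMap⁺ (λ v → map (v ∷_) (seqs n (length xs))) (∈-allFin x) (∈-map⁺ (x ∷_) (∈-seqs xs))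

  ∈-allSeqs : ∀ (xs : List (Fin n)) → length xs ≤ n → xs ∈ allSeqs n
  ∈-allSeqs xs h = ∈-concatMap⁺ (seqs n) (∈-upTo⁺ (s≤s h)) (∈-seqs xs)

  lastIs⇒≡lastOr : ∀ {y : Fin n} x xs → lastIs y (x ∷ xs) ≡ true → y ≡ lastOr x xs
  lastIs⇒≡lastOr x []       e = ==-true⇒≡ e
  lastIs⇒≡lastOr x (z ∷ xs) e = lastIs⇒≡lastOr z xs e

  lastIs-lastOr : ∀ (x : Fin n) xs → lastIs (lastOr x xs) (x ∷ xs) ≡ true
  lastIs-lastOr x []       = ==-refl x
  lastIs-lastOr x (z ∷ xs) = lastIs-lastOr z xs

  any-==⁻ : ∀ (x : Fin n) xs → any (x ==_) xs ≡ true → x ∈ xs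
  any-==⁻ x xs e with y , m , q ← any⁻ (x ==_) xs e = subst (_∈ xs) (sym (==-true⇒≡ q)) m

  any-==⁺ : ∀ (x : Fin n) xs → x ∈ xs → any (x ==_) xs ≡ true
  any-==⁺ x xs m = any⁺ (x ==_) m (==-refl x)

  distinct⇒∉ : ∀ (x : Fin n) xs → distinct (x ∷ xs) ≡ true → x ∉ xs
  distinct⇒∉ x xs d m = true≢false (trans (sym (any-==⁺ x xs m)) (not-elim (∧-elimˡ d)))

  distinct-tail : ∀ (x : Fin n) xs → distinct (x ∷ xs) ≡ true → distinct xs ≡ true
  distinct-tail x xs d = ∧-elimʳ {not (any (x ==_) xs)} d

  distinct-∷ : ∀ (x : Fin n) xs → x ∉ xs → distinct xs ≡ true → distinct (x ∷ xs) ≡ true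
  distinct-∷ x xs x∉ d = ∧-intro (not-intro (¬-not (x∉ ∘ any-==⁻ x xs))) d

  distinct-++ʳ : ∀ (xs ys : List (Fin n)) → distinct (xs ++ ys) ≡ true → distinct ys ≡ true
  distinct-++ʳ []       ys d = d
  distinct-++ʳ (x ∷ xs) ys d = distinct-++ʳ xs ys (distinct-tail x (xs ++ ys) d)

  distinct-∷ʳ : ∀ (xs : List (Fin n)) c → distinct xs ≡ true → c ∉ xs → distinct (xs ++ c ∷ []) ≡ true
  distinct-∷ʳ []       c d c∉ = refl
  distinct-∷ʳ (x ∷ xs) c d c∉ = distinct-∷ x (xs ++ c ∷ [])
    (λ m → case ∈-++⁻ xs m of λ where
       (inj₁ m′)          → distinct⇒∉ x xs d m′
       (inj₂ (here refl)) → c∉ (here refl))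
    (distinct-∷ʳ xs c (distinct-tail x xs d) (c∉ ∘ there))

  distinct⇒Unique : ∀ (xs : List (Fin n)) → distinct xs ≡ true → Unique xs
  distinct⇒Unique []       d = AllPairs.[]
  distinct⇒Unique (x ∷ xs) d =
    ¬Any⇒All¬ xs (distinct⇒∉ x xs d) AllPairs.∷ distinct⇒Unique xs (distinct-tail x xs d)

  distinct⇒length≤ : ∀ (xs : List (Fin n)) → distinct xs ≡ true → length xs ≤ n
  distinct⇒length≤ xs d = subst (length xs ≤_) (length-allFin n) (Unique-length≤ (distinct⇒Unique xs d) (λ {x} _ → ∈-allFin x))

  ¬distinct⇒repeat : ∀ (xs : List (Fin n)) → distinct xs ≡ false →
    Σ (List (Fin n)) λ pre → Σ (Fin n) λ z → Σ (List (Fin n)) λ mid → Σ (List (Fin n)) λ post →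
      xs ≡ pre ++ z ∷ mid ++ z ∷ post
  ¬distinct⇒repeat (x ∷ xs) d with any (x ==_) xs in e
  ... | true  = let (mid , post , eq) = ∈-∃++ (any-==⁻ x xs e) in [] , x , mid , post , cong (x ∷_) eq
  ... | false = let (pre , z , mid , post , eq) = ¬distinct⇒repeat xs d in x ∷ pre , z , mid , post , cong (x ∷_) eq

module Walks {n : ℕ} (S : EdgeSet n) where

  adjIn⁻ : ∀ x y → adjIn S x y ≡ true → (x , y) ∈ S ⊎ (y , x) ∈ S
  adjIn⁻ x y e with (a , b) , m , q ← any⁻ _ S e with ∨-elim {(a == x) ∧ (b == y)} q
  ... | inj₁ q₁ = inj₁ (subst₂ (λ p r → (p , r) ∈ S) (==-true⇒≡ (∧-elimˡ q₁)) (==-true⇒≡ (∧-elimʳ {a == x} q₁)) m)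
  ... | inj₂ q₂ = inj₂ (subst₂ (λ p r → (p , r) ∈ S) (==-true⇒≡ (∧-elimˡ q₂)) (==-true⇒≡ (∧-elimʳ {a == y} q₂)) m)

  adjIn⁺ : ∀ x y → (x , y) ∈ S → adjIn S x y ≡ true
  adjIn⁺ x y m = any⁺ _ m (∨-introˡ _ (∧-intro (==-refl x) (==-refl y)))

  adjIn⁺-flip : ∀ x y → (y , x) ∈ S → adjIn S x y ≡ true
  adjIn⁺-flip x y m = any⁺ _ m (∨-introʳ ((y == x) ∧ (x == y)) (∧-intro (==-refl y) (==-refl x)))

  adjIn-sym : ∀ x y → adjIn S x y ≡ true → adjIn S y x ≡ true
  adjIn-sym x y e = [ adjIn⁺-flip y x , adjIn⁺ y x ] (adjIn⁻ x y e)

  walkIn-++ : ∀ u qs rs → walkIn S (u ∷ qs) ≡ true → walkIn S (lastOr u qs ∷ rs) ≡ true → walkIn S (u ∷ qs ++ rs) ≡ true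
  walkIn-++ u []       rs w₁ w₂ = w₂
  walkIn-++ u (y ∷ qs) rs w₁ w₂ = ∧-intro (∧-elimˡ w₁) (walkIn-++ y qs rs (∧-elimʳ {adjIn S u y} w₁) w₂)

  walkIn-++⁻ : ∀ u qs rs → walkIn S (u ∷ qs ++ rs) ≡ true → walkIn S (u ∷ qs) ≡ true × walkIn S (lastOr u qs ∷ rs) ≡ true
  walkIn-++⁻ u []       rs w = refl , w
  walkIn-++⁻ u (y ∷ qs) rs w = let (w₁ , w₂) = walkIn-++⁻ y qs rs (∧-elimʳ {adjIn S u y} w) in ∧-intro (∧-elimˡ w) w₁ , w₂

  walkIn-split : ∀ xs y ys → walkIn S (xs ++ y ∷ ys) ≡ true → walkIn S (xs ++ y ∷ []) ≡ true × walkIn S (y ∷ ys) ≡ true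
  walkIn-split []       y ys w = refl , w
  walkIn-split (x ∷ xs) y ys w = let (w₁ , w₂) = walkIn-++⁻ x xs (y ∷ ys) w in
    walkIn-++ x xs (y ∷ []) w₁ (∧-intro (∧-elimˡ w₂) refl) , ∧-elimʳ {adjIn S (lastOr x xs) y} w₂

  walkIn-join : ∀ xs y ys → walkIn S (xs ++ y ∷ []) ≡ true → walkIn S (y ∷ ys) ≡ true → walkIn S (xs ++ y ∷ ys) ≡ true
  walkIn-join []       y ys w₁ w₂ = w₂
  walkIn-join (x ∷ xs) y ys w₁ w₂ =
    let (w₁′ , w₁″) = walkIn-++⁻ x xs (y ∷ []) w₁ in walkIn-++ x xs (y ∷ ys) w₁′ (∧-intro (∧-elimˡ w₁″) w₂)

  Walk : Fin n → Fin n → Set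
  Walk u w = Σ (List (Fin n)) λ qs → walkIn S (u ∷ qs) ≡ true × lastOr u qs ≡ w

  Path : Fin n → Fin n → Set
  Path u w = Σ (List (Fin n)) λ qs → distinct (u ∷ qs) ≡ true × walkIn S (u ∷ qs) ≡ true × lastOr u qs ≡ w

  Path⇒Walk : ∀ {u w} → Path u w → Walk u w
  Path⇒Walk (qs , _ , wk , l) = qs , wk , l

  walk-trans : ∀ {u w z} → Walk u w → Walk w z → Walk u z
  walk-trans {u} (qs , w₁ , l₁) (rs , w₂ , l₂) =
    qs ++ rs , walkIn-++ u qs rs w₁ (subst (λ a → walkIn S (a ∷ rs) ≡ true) (sym l₁) w₂) ,
    trans (lastOr-++ u qs rs) (trans (cong (λ a → lastOr a rs) l₁) l₂)

  walk-reverse : ∀ {u w} → Walk u w → Walk w u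
  walk-reverse {u} (qs , w₁ , refl) = reverse u qs w₁
    where
    reverse : ∀ u qs → walkIn S (u ∷ qs) ≡ true → Walk (lastOr u qs) u
    reverse u []       _  = [] , refl , refl
    reverse u (y ∷ qs) w₁ with rs , w₂ , l₂ ← reverse y qs (∧-elimʳ {adjIn S u y} w₁) =
      rs ++ u ∷ [] ,
      walkIn-++ _ rs (u ∷ []) w₂ (subst (λ a → walkIn S (a ∷ u ∷ []) ≡ true) (sym l₂) (∧-intro (adjIn-sym u y (∧-elimˡ w₁)) refl)) ,
      lastOr-++ _ rs (u ∷ [])

  -- cut out the segment between two visits of a repeated vertex, until none is left
  walk⇒path : ∀ {u w} → Walk u w → Path u w
  walk⇒path {u} {w} (qs , wk , l) = shorten (suc (length qs)) u qs ≤-refl wk l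
    where
    shorten : ∀ k u qs → length qs < k → walkIn S (u ∷ qs) ≡ true → lastOr u qs ≡ w → Path u w
    shorten (suc k) u qs len wk l with distinct (u ∷ qs) in d
    ... | true = qs , d , wk , l
    ... | false with ¬distinct⇒repeat (u ∷ qs) d
    ...   | [] , z , mid , post , refl =
      shorten k z post shorter (proj₂ (walkIn-split (z ∷ mid) z post wk)) (trans (sym (lastOr-++ z mid (z ∷ post))) l)
      where
      shorter : length post < k
      shorter = ≤-trans (≤-trans (m≤n+m (suc (length post)) (length mid)) (≤-reflexive (sym (length-++ mid)))) (s≤s⁻¹ len)
    ...   | p₀ ∷ pre , z , mid , post , refl =
      let w₁ = walkIn-split (p₀ ∷ pre) z (mid ++ z ∷ post) wk
          w₂ = walkIn-split (z ∷ mid) z post (proj₂ w₁)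
      in shorten k p₀ (pre ++ z ∷ post) shorter (walkIn-join (p₀ ∷ pre) z post (proj₁ w₁) (proj₂ w₂))
           (trans (lastOr-++ p₀ pre (z ∷ post)) (trans (sym (lastOr-++ z mid (z ∷ post)))
             (trans (sym (lastOr-++ p₀ pre (z ∷ mid ++ z ∷ post))) l)))
      where
      open ≤-Reasoning
      shorter : length (pre ++ z ∷ post) < k
      shorter = begin
        suc (length (pre ++ z ∷ post))              ≡⟨ cong suc (length-++ pre) ⟩
        suc (length pre + suc (length post))        ≡⟨ +-suc (length pre) _ ⟨
        length pre + suc (suc (length post))
          ≤⟨ +-monoʳ-≤ (length pre) (s≤s (≤-trans (m≤n+m (suc (length post)) (length mid)) (≤-reflexive (sym (length-++ mid))))) ⟩
        length pre + suc (length (mid ++ z ∷ post)) ≡⟨ length-++ pre ⟨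
        length (pre ++ z ∷ mid ++ z ∷ post)         ≤⟨ s≤s⁻¹ len ⟩
        k                                           ∎

  connected⇒Path : ∀ u w → connected S u w ≡ true → Path u w
  connected⇒Path u w e with (x ∷ qs) , _ , q ← any⁻ (λ p → isPath S p ∧ startsAt u p ∧ lastIs w p) (allSeqs n) e
    with refl ← ==-true⇒≡ {u = u} {x} (∧-elimˡ (∧-elimʳ {isPath S (x ∷ qs)} q)) =
    let ip = ∧-elimˡ {isPath S (u ∷ qs)} q
    in qs , ∧-elimˡ {distinct (u ∷ qs)} ip , ∧-elimʳ {distinct (u ∷ qs)} ip ,
       sym (lastIs⇒≡lastOr u qs (∧-elimʳ {startsAt u (u ∷ qs)} (∧-elimʳ {isPath S (u ∷ qs)} q)))

  Path⇒connected : ∀ u w → Path u w → connected S u w ≡ true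
  Path⇒connected u w (qs , d , wk , l) =
    any⁺ (λ p → isPath S p ∧ startsAt u p ∧ lastIs w p) (∈-allSeqs (u ∷ qs) (distinct⇒length≤ (u ∷ qs) d))
      (∧-intro (∧-intro d wk) (∧-intro (==-refl u) (subst (λ a → lastIs a (u ∷ qs) ≡ true) l (lastIs-lastOr u qs))))

  walk⇒connected : ∀ {u w} → Walk u w → connected S u w ≡ true
  walk⇒connected {u} {w} = Path⇒connected u w ∘ walk⇒path

-- Increasing forests

module _ {n : ℕ} where

  increasing-last : ∀ (zs : List (Fin n)) a b → increasingSeq (zs ++ a ∷ b ∷ []) ≡ true → toℕ a < toℕ b
  increasing-last []            a b e = <ᵛ-true⇒< {u = a} {b} (∧-elimˡ e)
  increasing-last (z ∷ [])      a b e = increasing-last [] a b (∧-elimʳ {z <ᵛ a} e)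
  increasing-last (z ∷ z′ ∷ zs) a b e = increasing-last (z′ ∷ zs) a b (∧-elimʳ {z <ᵛ z′} e)

  increasing-head : ∀ (x : Fin n) zs {y} → increasingSeq (x ∷ zs) ≡ true → y ∈ zs → toℕ x < toℕ y
  increasing-head x (z ∷ zs) e (here refl) = <ᵛ-true⇒< {u = x} {z} (∧-elimˡ e)
  increasing-head x (z ∷ zs) e (there m)   =
    <-trans (<ᵛ-true⇒< {u = x} {z} (∧-elimˡ e)) (increasing-head z zs (∧-elimʳ {x <ᵛ z} e) m)

  increasing-∷ʳ : ∀ (u : Fin n) qs c → increasingSeq (u ∷ qs ++ c ∷ []) ≡ true → toℕ (lastOr u qs) < toℕ c
  increasing-∷ʳ u []       c e = <ᵛ-true⇒< {u = u} {c} (∧-elimˡ e)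
  increasing-∷ʳ u (y ∷ qs) c e = increasing-∷ʳ y qs c (∧-elimʳ {u <ᵛ y} e)

module _ {A : Set} where

  initLastTwo : ∀ (x y : A) rest → Σ (List A) λ ys → Σ A λ a → Σ A λ b → x ∷ y ∷ rest ≡ ys ++ a ∷ b ∷ []
  initLastTwo x y []         = [] , x , y , refl
  initLastTwo x y (z ∷ rest) = let (ys , a , b , e) = initLastTwo y z rest in x ∷ ys , a , b , cong (x ∷_) e

  lastTwo-injectiveˡ : ∀ (xs ys : List A) {a a′ b b′} → xs ++ a ∷ b ∷ [] ≡ ys ++ a′ ∷ b′ ∷ [] → a ≡ a′
  lastTwo-injectiveˡ xs ys e =
    ∷ʳ-injectiveʳ xs ys (∷ʳ-injectiveˡ (xs ++ _ ∷ []) (ys ++ _ ∷ [])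
      (trans (++-assoc xs _ _) (trans e (sym (++-assoc ys _ _)))))

UniqueLowerNeighbours : ∀ {n} → EdgeSet n → Set
UniqueLowerNeighbours S = ∀ {a a′ b} → (a , b) ∈ S → (a′ , b) ∈ S → a ≡ a′

module _ {n : ℕ} where

  repeatedHead : ∀ (U : Fin n → Bool) c d T {a} → freshHeads U ((c , d) ∷ T) ≡ true → (a , d) ∉ T
  repeatedHead U c d T fresh m = true≢false (trans (sym (∨-introʳ (U d) (==-refl d)))
    (freshHeads⇒unmarked (mark U d) T (∧-elimʳ {not (U d)} fresh) m))

  freshHeads⇒UniqueLowerNeighbours : ∀ (U : Fin n → Bool) S → freshHeads U S ≡ true → UniqueLowerNeighbours S
  freshHeads⇒UniqueLowerNeighbours U ((c , d) ∷ T) fresh (here refl) (here refl) = refl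
  freshHeads⇒UniqueLowerNeighbours U ((c , d) ∷ T) fresh (here refl) (there m)   = ⊥-elim (repeatedHead U c d T fresh m)
  freshHeads⇒UniqueLowerNeighbours U ((c , d) ∷ T) fresh (there m)   (here refl) = ⊥-elim (repeatedHead U c d T fresh m)
  freshHeads⇒UniqueLowerNeighbours U ((c , d) ∷ T) fresh (there m)   (there m′)  =
    freshHeads⇒UniqueLowerNeighbours (mark U d) T (∧-elimʳ {not (U d)} fresh) m m′

  UniqueLowerNeighbours⇒freshHeads : ∀ (U : Fin n → Bool) S → Unique S → (∀ {a b} → (a , b) ∈ S → U b ≡ false) →
    UniqueLowerNeighbours S → freshHeads U S ≡ true
  UniqueLowerNeighbours⇒freshHeads U []            _                    _        _   = refl
  UniqueLowerNeighbours⇒freshHeads U ((c , d) ∷ T) (cd∉ AllPairs.∷ uT) unmarked uln =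
    ∧-intro (not-intro (unmarked (here refl)))
      (UniqueLowerNeighbours⇒freshHeads (mark U d) T uT unmarked′ (λ m m′ → uln (there m) (there m′)))
    where
    unmarked′ : ∀ {x y} → (x , y) ∈ T → mark U d y ≡ false
    unmarked′ {x} {y} m rewrite unmarked (there m) = ≢⇒==-false λ y≡d →
      All.lookup cd∉ m (cong₂ _,_ (uln (here refl) (subst (λ z → (x , z) ∈ (c , d) ∷ T) y≡d (there m))) (sym y≡d))

module IncreasingForest {n : ℕ} (S : EdgeSet n) (upward : ∀ {a b} → (a , b) ∈ S → toℕ a < toℕ b) where
  open Walks S
  open import Data.List.Membership.DecPropositional (Finₚ._≟_ {n}) using (_∈?_)

  lowerEdge : ∀ x w → adjIn S x w ≡ true → toℕ x < toℕ w → (x , w) ∈ S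
  lowerEdge x w e x<w = [ id , (λ m → ⊥-elim (<-asym x<w (upward m))) ] (adjIn⁻ x w e)

  module _ (uln : UniqueLowerNeighbours S) where

    lowerNeighbour-unique : ∀ a b w → adjIn S a w ≡ true → adjIn S b w ≡ true → toℕ a < toℕ w → toℕ b < toℕ w → a ≡ b
    lowerNeighbour-unique a b w ea eb a<w b<w = uln (lowerEdge a w ea a<w) (lowerEdge b w eb b<w)

    -- once a path has gone up it can never come down: that would give a vertex two lower neighbours
    ascending⇒increasing : ∀ x y xs → distinct (x ∷ y ∷ xs) ≡ true → walkIn S (x ∷ y ∷ xs) ≡ true → toℕ x < toℕ y →
      increasingSeq (x ∷ y ∷ xs) ≡ true
    ascending⇒increasing x y []       d w x<y = ∧-intro (<⇒<ᵛ-true {u = x} {y} x<y) refl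
    ascending⇒increasing x y (z ∷ xs) d w x<y with <-cmp (toℕ z) (toℕ y)
    ... | tri< z<y _ _ = ⊥-elim (distinct⇒∉ x (y ∷ z ∷ xs) d
            (there (here (lowerNeighbour-unique x z y (∧-elimˡ w) (adjIn-sym y z (∧-elimˡ (∧-elimʳ {adjIn S x y} w))) x<y z<y))))
    ... | tri≈ _ z≡y _ = ⊥-elim (distinct⇒∉ y (z ∷ xs) (distinct-tail x (y ∷ z ∷ xs) d) (here (toℕ-injective (sym z≡y))))
    ... | tri> _ _ y<z = ∧-intro (<⇒<ᵛ-true {u = x} {y} x<y)
            (ascending⇒increasing y z xs (distinct-tail x (y ∷ z ∷ xs) d) (∧-elimʳ {adjIn S x y} w) y<z)

    descendingEnd⇒belowStart : ∀ x ys a b → distinct (x ∷ ys ++ a ∷ b ∷ []) ≡ true → walkIn S (x ∷ ys ++ a ∷ b ∷ []) ≡ true →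
      toℕ b < toℕ a → toℕ b < toℕ x
    descendingEnd⇒belowStart x [] a b d w b<a with <-cmp (toℕ x) (toℕ a)
    ... | tri< x<a _ _ = ⊥-elim (distinct⇒∉ x (a ∷ b ∷ []) d (there (here
            (lowerNeighbour-unique x b a (∧-elimˡ w) (adjIn-sym a b (∧-elimˡ (∧-elimʳ {adjIn S x a} w))) x<a b<a))))
    ... | tri≈ _ x≡a _ = ⊥-elim (distinct⇒∉ x (a ∷ b ∷ []) d (here (toℕ-injective x≡a)))
    ... | tri> _ _ a<x = <-trans b<a a<x
    descendingEnd⇒belowStart x (y ∷ ys) a b d w b<a with <-cmp (toℕ x) (toℕ y)
    ... | tri< x<y _ _ = ⊥-elim (<-asym b<a (increasing-last (x ∷ y ∷ ys) a b (ascending⇒increasing x y (ys ++ a ∷ b ∷ []) d w x<y)))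
    ... | tri≈ _ x≡y _ = ⊥-elim (distinct⇒∉ x (y ∷ ys ++ a ∷ b ∷ []) d (here (toℕ-injective x≡y)))
    ... | tri> _ _ y<x = <-trans
      (descendingEnd⇒belowStart y ys a b (distinct-tail x (y ∷ ys ++ a ∷ b ∷ []) d) (∧-elimʳ {adjIn S x y} w) b<a) y<x

    -- a cycle x₀ x₁ … a b closed by the edge b x₀
    no-cycle : ∀ x₀ x₁ rest ys a b → x₁ ∷ rest ≡ ys ++ a ∷ b ∷ [] →
      distinct (x₀ ∷ x₁ ∷ rest) ≡ true → walkIn S (x₀ ∷ x₁ ∷ rest) ≡ true → adjIn S b x₀ ≡ true → ⊥
    no-cycle x₀ x₁ rest ys a b eq d w bx₀ = compareStart (<-cmp (toℕ x₀) (toℕ x₁))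
      where
      d′ : distinct (x₀ ∷ ys ++ a ∷ b ∷ []) ≡ true
      d′ = subst (λ z → distinct (x₀ ∷ z) ≡ true) eq d
      w′ : walkIn S (x₀ ∷ ys ++ a ∷ b ∷ []) ≡ true
      w′ = subst (λ z → walkIn S (x₀ ∷ z) ≡ true) eq w
      ab : adjIn S a b ≡ true
      ab = ∧-elimˡ (proj₂ (walkIn-split (x₀ ∷ ys) a (b ∷ []) w′))
      a∈ : a ∈ ys ++ a ∷ b ∷ []
      a∈ = ∈-++⁺ʳ ys (here refl)
      b∈ : b ∈ ys ++ a ∷ b ∷ []
      b∈ = ∈-++⁺ʳ ys (there (here refl))
      x₀≢a : x₀ ≢ a
      x₀≢a refl = distinct⇒∉ x₀ (ys ++ a ∷ b ∷ []) d′ a∈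
      x₀≢b : x₀ ≢ b
      x₀≢b refl = distinct⇒∉ x₀ (ys ++ a ∷ b ∷ []) d′ b∈
      a≢b : a ≢ b
      a≢b a≡b = distinct⇒∉ a (b ∷ []) (distinct-++ʳ (x₀ ∷ ys) (a ∷ b ∷ []) d′) (here a≡b)
      x₁≢b : x₁ ≢ b
      x₁≢b refl = distinct⇒∉ x₁ rest (distinct-tail x₀ (x₁ ∷ rest) d) (b∈rest ys eq)
        where
        b∈rest : ∀ ys → x₁ ∷ rest ≡ ys ++ a ∷ x₁ ∷ [] → x₁ ∈ rest
        b∈rest []       refl = here refl
        b∈rest (y ∷ ys) refl = ∈-++⁺ʳ ys (there (here refl))
      compareStart : Tri (toℕ x₀ < toℕ x₁) (toℕ x₀ ≡ toℕ x₁) (toℕ x₁ < toℕ x₀) → ⊥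
      compareStart (tri< x₀<x₁ _ _) =
        let inc = subst (λ z → increasingSeq (x₀ ∷ z) ≡ true) eq (ascending⇒increasing x₀ x₁ rest d w x₀<x₁)
        in x₀≢a (sym (lowerNeighbour-unique a x₀ b ab (adjIn-sym b x₀ bx₀)
                       (increasing-last (x₀ ∷ ys) a b inc) (increasing-head x₀ (ys ++ a ∷ b ∷ []) inc b∈)))
      compareStart (tri≈ _ x₀≡x₁ _) = distinct⇒∉ x₀ (x₁ ∷ rest) d (here (toℕ-injective x₀≡x₁))
      compareStart (tri> _ _ x₁<x₀) with <-cmp (toℕ b) (toℕ x₀)
      ... | tri< b<x₀ _ _ = x₁≢b (lowerNeighbour-unique x₁ b x₀ (adjIn-sym x₀ x₁ (∧-elimˡ w)) bx₀ x₁<x₀ b<x₀)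
      ... | tri≈ _ b≡x₀ _ = x₀≢b (toℕ-injective (sym b≡x₀))
      ... | tri> _ _ x₀<b with <-cmp (toℕ a) (toℕ b)
      ...   | tri< a<b _ _ = x₀≢a (sym (lowerNeighbour-unique a x₀ b ab (adjIn-sym b x₀ bx₀) a<b x₀<b))
      ...   | tri≈ _ a≡b _ = a≢b (toℕ-injective a≡b)
      ...   | tri> _ _ b<a = <-asym x₀<b (descendingEnd⇒belowStart x₀ ys a b d′ w′ b<a)

    not-a-cycle : ∀ p → atLeast3 p ∧ isPath S p ∧ closes S p ≡ false
    not-a-cycle []           = refl
    not-a-cycle (_ ∷ [])     = refl
    not-a-cycle (_ ∷ _ ∷ []) = refl
    not-a-cycle (x₀ ∷ x₁ ∷ x₂ ∷ rest) = ¬-not λ e →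
      let p = x₀ ∷ x₁ ∷ x₂ ∷ rest
          isP = ∧-elimˡ (∧-elimʳ {true} e)
          (y , _ , q) = any⁻ (λ y → lastIs y p ∧ adjIn S y x₀) (allFin n) (∧-elimʳ {isPath S p} (∧-elimʳ {true} e))
          (ys , a , b , eq) = initLastTwo x₁ x₂ rest
          y≡b = trans (lastIs⇒≡lastOr x₀ (x₁ ∷ x₂ ∷ rest) (∧-elimˡ q)) (trans (cong (lastOr x₀) eq) (lastOr-++ x₀ ys (a ∷ b ∷ [])))
      in no-cycle x₀ x₁ (x₂ ∷ rest) ys a b eq (∧-elimˡ isP) (∧-elimʳ {distinct p} isP)
           (subst (λ z → adjIn S z x₀ ≡ true) y≡b (∧-elimʳ {lastIs y p} q))

    fromComponentMin-increasing : ∀ p → not (isPath S p ∧ startsAtComponentMin S p) ∨ increasingSeq p ≡ true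
    fromComponentMin-increasing []             = refl
    fromComponentMin-increasing (m ∷ [])       = ∨-introʳ (not (isPath S (m ∷ []) ∧ startsAtComponentMin S (m ∷ []))) refl
    fromComponentMin-increasing (m ∷ y ∷ rest) = ⇒-intro (isPath S (m ∷ y ∷ rest) ∧ isComponentMin S m) λ e →
      let isP = ∧-elimˡ {isPath S (m ∷ y ∷ rest)} e
          d   = ∧-elimˡ {distinct (m ∷ y ∷ rest)} isP
          w   = ∧-elimʳ {distinct (m ∷ y ∷ rest)} isP
          m≢y = λ m≡y → distinct⇒∉ m (y ∷ rest) d (here m≡y)
          m~y = Path⇒connected m y (y ∷ [] , distinct-∷ m (y ∷ []) (λ { (here m≡y) → m≢y m≡y }) refl , ∧-intro (∧-elimˡ w) refl , refl)
          m≤y = ≤ᵇ-true⇒≤ (⇒-elim (all⁻ _ (allFin n) (∧-elimʳ {isPath S (m ∷ y ∷ rest)} e) (∈-allFin y)) m~y)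
      in ascending⇒increasing m y rest d w (≤∧≢⇒< m≤y (m≢y ∘ toℕ-injective))

    UniqueLowerNeighbours⇒increasingForest : isIncreasingForest S ≡ true
    UniqueLowerNeighbours⇒increasingForest = ∧-intro
      (not-intro (none⇒any-false (λ p → atLeast3 p ∧ isPath S p ∧ closes S p) (allSeqs n) (λ p _ → not-a-cycle p)))
      (all⁺ (λ p → not (isPath S p ∧ startsAtComponentMin S p) ∨ increasingSeq p) (allSeqs n) (λ p _ → fromComponentMin-increasing p))

  module _ (isIF : isIncreasingForest S ≡ true) where

    acyclic : hasCycle S ≡ false
    acyclic = not-elim (∧-elimˡ isIF)

    increasingFromRoots : ∀ {p} → isPath S p ∧ startsAtComponentMin S p ≡ true → length p ≤ n → increasingSeq p ≡ true
    increasingFromRoots {p} e len =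
      ⇒-elim (all⁻ (λ p → not (isPath S p ∧ startsAtComponentMin S p) ∨ increasingSeq p) (allSeqs n)
        (∧-elimʳ {isForest S} isIF) (∈-allSeqs p len)) e

    module _ (b : Fin n) where

      root : Fin n
      root = argmin toℕ b (filterᵇ (connected S b) (allFin n))

      b~root : connected S b root ≡ true
      b~root = [ (λ root≡b → subst (λ z → connected S b z ≡ true) (sym root≡b) (Path⇒connected b b ([] , refl , refl , refl)))
               , (λ m → proj₂ (∈-filterᵇ⁻ (connected S b) {xs = allFin n} m)) ]′
               (argmin-sel toℕ b (filterᵇ (connected S b) (allFin n)))

      root-minimal : ∀ u → connected S b u ≡ true → toℕ root ≤ toℕ u
      root-minimal u e = All.lookup (f[argmin]≤f[xs] b _) (∈-filterᵇ⁺ (connected S b) (∈-allFin u) e)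

      root-isComponentMin : isComponentMin S root ≡ true
      root-isComponentMin = all⁺ _ (allFin n) λ u _ → ⇒-intro (connected S root u) λ e → ≤⇒≤ᵇ-true (root-minimal u
        (walk⇒connected (walk-trans (Path⇒Walk (connected⇒Path b root b~root)) (Path⇒Walk (connected⇒Path root u e)))))

      rootPath : Path root b
      rootPath = walk⇒path (walk-reverse (Path⇒Walk (connected⇒Path b root b~root)))

    -- extending the path by a lower neighbour would break monotonicity, and meeting it earlier would close a cycle
    lowerNeighbour-precedes : ∀ {r b} → isComponentMin S r ≡ true → ∀ c → (c , b) ∈ S → ((qs , _) : Path r b) →
      Σ (List (Fin n)) λ pre → r ∷ qs ≡ pre ++ c ∷ b ∷ []
    lowerNeighbour-precedes {r} {b} rMin c cb (qs , d , w , l) with c ∈? (r ∷ qs)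
    ... | no c∉ = ⊥-elim (<-asym (upward cb) (subst (λ z → toℕ z < toℕ c) l (increasing-∷ʳ r qs c increasing)))
      where
      d′ = distinct-∷ʳ (r ∷ qs) c d c∉
      w′ = walkIn-++ r qs (c ∷ []) w (∧-intro (subst (λ z → adjIn S z c ≡ true) (sym l) (adjIn⁺-flip b c cb)) refl)
      increasing : increasingSeq (r ∷ qs ++ c ∷ []) ≡ true
      increasing = increasingFromRoots {r ∷ qs ++ c ∷ []} (∧-intro (∧-intro d′ w′) rMin) (distinct⇒length≤ (r ∷ qs ++ c ∷ []) d′)
    ... | yes c∈ with pre , post , eq ← ∈-∃++ c∈ = afterC post refl
      where
      lastPost : lastOr c post ≡ b
      lastPost = trans (sym (trans (cong (lastOr b) eq) (lastOr-++ b pre (c ∷ post)))) l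
      afterC : ∀ post′ → post′ ≡ post → Σ (List (Fin n)) λ pre′ → r ∷ qs ≡ pre′ ++ c ∷ b ∷ []
      afterC []                refl = ⊥-elim (<-irrefl (cong toℕ lastPost) (upward cb))
      afterC (y ∷ [])          refl = pre , trans eq (cong (λ z → pre ++ c ∷ z ∷ []) lastPost)
      afterC (y₁ ∷ y₂ ∷ post′) refl = ⊥-elim (true≢false (trans (sym hasC) acyclic))
        where
        C = c ∷ y₁ ∷ y₂ ∷ post′
        dC : distinct C ≡ true
        dC = distinct-++ʳ pre C (subst (λ z → distinct z ≡ true) eq d)
        wC : walkIn S C ≡ true
        wC = proj₂ (walkIn-split pre c (y₁ ∷ y₂ ∷ post′) (subst (λ z → walkIn S z ≡ true) eq w))
        closesC : closes S C ≡ true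
        closesC = any⁺ (λ y → lastIs y C ∧ adjIn S y c) (∈-allFin b)
          (∧-intro (subst (λ z → lastIs z C ≡ true) lastPost (lastIs-lastOr c (y₁ ∷ y₂ ∷ post′))) (adjIn⁺-flip b c cb))
        hasC : hasCycle S ≡ true
        hasC = any⁺ (λ p → atLeast3 p ∧ isPath S p ∧ closes S p) (∈-allSeqs C (distinct⇒length≤ C dC))
          (∧-intro refl (∧-intro (∧-intro dC wC) closesC))

    increasingForest⇒UniqueLowerNeighbours : UniqueLowerNeighbours S
    increasingForest⇒UniqueLowerNeighbours {c} {c′} {b} cb c′b =
      let (pre , e) = lowerNeighbour-precedes (root-isComponentMin b) c cb (rootPath b)
          (pre′ , e′) = lowerNeighbour-precedes (root-isComponentMin b) c′ c′b (rootPath b)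
      in lastTwo-injectiveˡ pre pre′ (trans (sym e) e′)

increasingForest≡freshHeads : ∀ {n} (G : Graph n) S → S ∈ sublists (edges G) →
  isIncreasingForest S ≡ freshHeads (λ _ → false) S
increasingForest≡freshHeads G S S⊆E with freshHeads (λ _ → false) S in fresh
... | true  = IncreasingForest.UniqueLowerNeighbours⇒increasingForest S (Edges.sublist-upward G S⊆E)
                (freshHeads⇒UniqueLowerNeighbours _ S fresh)
... | false = ¬-not λ isIF → true≢false (trans (sym
                (UniqueLowerNeighbours⇒freshHeads _ S (Edges.sublist-Unique G S⊆E) (λ _ → refl)
                  (IncreasingForest.increasingForest⇒UniqueLowerNeighbours S (Edges.sublist-upward G S⊆E) isIF))) fresh)

module IFFormula {n′ : ℕ} (G : Graph (suc n′)) (t : ℕ) where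

  private
    n = suc n′
    E = edges G
  open SignedSum {n} t

  none : Fin n → Bool
  none _ = false

  #unmarked-none : #unmarked none ≡ n
  #unmarked-none = trans (count-true (allFin n)) (length-allFin n)

  IF≡degreeProductℤ : IF G t ≡ Greedy.degreeProductℤ G t (allFin n)
  IF≡degreeProductℤ = begin
    IF G t                                       ≡⟨ sumℤ-cong _ _ (upTo n) (λ k _ → byForest k) ⟩
    sumℤ (map (λ k → sumℤ (map (λ S → δ S k) (sublists E))) (upTo n))
                                                 ≡⟨ sumℤ-swap (λ k S → δ S k) (upTo n) (sublists E) ⟩
    sumℤ (map (λ S → sumℤ (map (δ S) (upTo n))) (sublists E))
                                                 ≡⟨ sumℤ-cong _ _ (sublists E) (λ S m → bySize S m) ⟩
    freshHeadsSum none E                         ≡⟨ freshHeadsSum≡factorProduct E none ⟩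
    factorProduct none E
      ≡⟨ prodℤ-cong _ _ (allFin n) (λ v _ → cong (λ d → + t -ℤ + d) (Edges.headCount-edges G v)) ⟩
    Greedy.degreeProductℤ G t (allFin n)         ∎
    where
    open ≡-Reasoning
    w : ℕ → ℤ
    w = signedPower n
    δ : EdgeSet n → ℕ → ℤ
    δ S k = if isIncreasingForest S ∧ (length S ≡ᵇ k) then w k else + 0
    byForest : ∀ k → (- + 1) ℤ.^ k *ℤ + (forestCount G k * t ^ (n ∸ k)) ≡ sumℤ (map (λ S → δ S k) (sublists E))
    byForest k = trans (cong ((- + 1) ℤ.^ k *ℤ_) (ℤₚ.pos-* (forestCount G k) _))
      (trans (swap ((- + 1) ℤ.^ k) (+ forestCount G k) _) (sym (sumℤ-if≡count* _ (w k) (sublists E))))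
      where
      swap : ∀ a b c → a *ℤ (b *ℤ c) ≡ b *ℤ (a *ℤ c)
      swap = solve-∀
    bySize : ∀ S → S ∈ sublists E → sumℤ (map (δ S) (upTo n)) ≡ term none S
    bySize S m rewrite increasingForest≡freshHeads G S m with freshHeads none S in fresh
    ... | true  = trans (sumℤ-upTo-δ w n (freshHeads⇒length< G m none fresh))
                        (cong (λ m → signedPower m (length S)) (sym #unmarked-none))
    ... | false = sumℤ≡0 _ (upTo n) (λ _ _ → refl)

-- recolouring k like j keeps the identity colouring proper, as j and k are not adjacent
nonPEO⇒degreeProduct<chromatic : ∀ {n} (G : Graph n) {i j k : Fin n} → toℕ j < toℕ i → toℕ k < toℕ i →
  adj G i j ≡ true → adj G i k ≡ true → j ≢ k → adj G j k ≡ false → Greedy.degreeProduct G n (allFin n) < chromatic G n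
nonPEO⇒degreeProduct<chromatic {n} G {i} {j} {k} j<i k<i aij aik j≢k ¬ajk =
  Greedy.degreeProduct<chromatic G n κ κ-proper (lowerDegree<n G)
    (∈-lowerNeighbours⁺ G j<i (trans (Graph.sym G j i) aij)) (∈-lowerNeighbours⁺ G k<i (trans (Graph.sym G k i) aik))
    j≢k κj≡κk
  where
  κ : Fin n → Fin n
  κ u = if u == k then j else u
  κj≡κk : κ j ≡ κ k
  κj≡κk rewrite ==-refl k | ≢⇒==-false j≢k = refl
  noLoop : ∀ {u w} → u ≡ w → adj G u w ≡ true → ⊥
  noLoop {u} refl a = true≢false (trans (sym a) (Graph.irrefl G u))
  nonEdge : ∀ {u w} → u ≡ k → w ≡ j → adj G u w ≡ true → ⊥
  nonEdge refl refl a = true≢false (trans (sym a) (trans (Graph.sym G k j) ¬ajk))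
  κ-proper : ∀ u w → adj G u w ≡ true → κ u ≢ κ w
  κ-proper u w a κu≡κw with u == k in uk | w == k in wk
  ... | true  | true  = noLoop (trans (==-true⇒≡ uk) (sym (==-true⇒≡ wk))) a
  ... | true  | false = nonEdge (==-true⇒≡ uk) (sym κu≡κw) a
  ... | false | true  = nonEdge (==-true⇒≡ wk) κu≡κw (trans (Graph.sym G w u) a)
  ... | false | false = noLoop κu≡κw a

theorem6p4 : (n : ℕ) → 1 ≤ n → (G : Graph n) →
    ((t : ℕ) → + chromatic G t ≡ IF G t) ⇔ PerfectEliminationOrdering G
theorem6p4 (suc n) _ G = mk⇔ equal⇒PEO PEO⇒equal
  where
  PEO⇒equal : PerfectEliminationOrdering G → ∀ t → + chromatic G t ≡ IF G t
  PEO⇒equal peo t = trans (Greedy.chromatic-PEO G t peo) (sym (IFFormula.IF≡degreeProductℤ G t))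

  equal⇒PEO : (∀ t → + chromatic G t ≡ IF G t) → PerfectEliminationOrdering G
  equal⇒PEO eq i j k j<i k<i aij aik j≢k with adj G j k in ajk
  ... | true  = refl
  ... | false = ⊥-elim (<-irrefl (sym chromatic≡degreeProduct) (nonPEO⇒degreeProduct<chromatic G j<i k<i aij aik j≢k ajk))
    where
    chromatic≡degreeProduct : chromatic G (suc n) ≡ Greedy.degreeProduct G (suc n) (allFin (suc n))
    chromatic≡degreeProduct = ℤₚ.+-injective (trans (eq (suc n)) (trans (IFFormula.IF≡degreeProductℤ G (suc n))
      (Greedy.degreeProductℤ≡degreeProduct G (suc n) (<⇒≤ ∘ lowerDegree<n G) (allFin (suc n)))))
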